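{- For primes $p>2$, \[Q(1,p^2)=1+O\Big(\frac1p\Big),\qquad Q(p^2,1)=O\Big(\frac1p\Big).\]
   Context: For $t\in\mathbb{Z}$ let $E_t:y^2=x^3+tx^2-(t+3)x+1$ and $C(t)=2^3(t^2+3t+9)^2$. For an odd prime $p$ and $t\bmod p$: $\lambda_t(p)=-p^{ -1/2}\sum_{x\bmod p}\big(\frac{x^3+tx^2-(t+3)x+1}{p}\big)$ (Legendre symbol); $\psi_t(p)=1$ if $p\nmid C(t)$ and $0$ otherwise; $\lambda_t(1)=1$, $\lambda_t(p^2)=\lambda_t(p)^2-1$ if $\psi_t(p)=1$ and $\lambda_t(p^2)=\lambda_t(p)^2$ otherwise; $\mu_t(1)=1$, $\mu_t(p^2)=\psi_t(p)$. $Q(p^{m_1},p^{m_2})=\frac1p\sum_{t\bmod p}\lambda_t(p^{m_1})\mu_t(p^{m_2})$. Implied constants are absolute. -}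

module Defs where

open import Data.Nat as ℕ using (ℕ; zero; suc; _≡ᵇ_; _%_)
open import Data.Integer as ℤ using (ℤ; +_; -[1+_])
open import Data.Integer.DivMod using (_%ℕ_)
open import Data.Nat.Divisibility using (_∣?_)
open import Data.Rational as ℚ using (ℚ)
open import Data.List using (List; upTo; map; foldr)
open import Data.Bool.ListAction using (any)
open import Data.Bool using (Bool; true; false; if_then_else_)
open import Relation.Nullary.Decidable using (⌊_⌋)

-- Legendre symbol (a / p) for a modulus p (used only for odd primes p):
-- 0 if p ∣ a, 1 if a is a nonzero square mod p, -1 otherwise.
legendre : ℕ → ℤ → ℤ
legendre zero a = + 0
legendre (suc k) a with a %ℕ suc k
... | zero = + 0
... | r@(suc _) =
  if any (λ x → ((x ℕ.* x) % suc k) ≡ᵇ r) (upTo (suc k)) then + 1 else ℤ.- (+ 1)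

sumℤ : List ℤ → ℤ
sumℤ = foldr ℤ._+_ (+ 0)

sumℚ : List ℚ → ℚ
sumℚ = foldr ℚ._+_ ℚ.0ℚ

cubic : ℤ → ℤ → ℤ
cubic t x = x ℤ.* x ℤ.* x ℤ.+ t ℤ.* x ℤ.* x ℤ.- (t ℤ.+ + 3) ℤ.* x ℤ.+ + 1

Ccond : ℤ → ℤ
Ccond t = + 8 ℤ.* (q ℤ.* q)
  where q = t ℤ.* t ℤ.+ + 3 ℤ.* t ℤ.+ + 9

-- S_t(p) = Σ_{x mod p} ( (x^3+tx^2-(t+3)x+1) / p ), so λ_t(p) = - p^{-1/2} S_t(p)
charSum : ℕ → ℤ → ℤ
charSum p t = sumℤ (map (λ x → legendre p (cubic t (+ x))) (upTo p))

-- 1/p as a rational (junk value 0 at p = 0, never used)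
inv : ℕ → ℚ
inv zero = ℚ.0ℚ
inv (suc k) = + 1 ℚ./ suc k

psi : ℕ → ℤ → ℚ
psi p t = if ⌊ p ∣? ℤ.∣ Ccond t ∣ ⌋ then ℚ.0ℚ else ℚ.1ℚ

-- λ_t(p)^2 = p^{-1} S_t(p)^2  (exact, rational)
lamSq : ℕ → ℤ → ℚ
lamSq p t = ℚ._*_ (ℚ._/_ (charSum p t ℤ.* charSum p t) 1) (inv p)

-- the two prime powers occurring: 1 = p^0 and p^2
data Pw : Set where
  one sq : Pw

lam : Pw → ℕ → ℤ → ℚ
lam one p t = ℚ.1ℚ
lam sq p t = lamSq p t ℚ.- psi p t

mu : Pw → ℕ → ℤ → ℚ
mu one p t = ℚ.1ℚ
mu sq p t = psi p t

Q : Pw → Pw → ℕ → ℚ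
Q m1 m2 p = inv p ℚ.* sumℚ (map (λ t → lam m1 p (+ t) ℚ.* mu m2 p (+ t)) (upTo p))

-- Write χ for the Legendre symbol modulo p and g x = x³ − 3x + 1, h x = x² − x, so that the
-- cubic of E_t is g x + t h x and λ_t(p)² = S_t² / p with S_t = Σ_x χ(g x + t h x).
--
-- Q(1,p²) = 1 − #{t : p ∣ t² + 3t + 9} / p, and a quadratic has at most χ(Δ) + 1 ≤ 2 roots.
--
-- For Q(p²,1) = p⁻² (Σ_t S_t² − p Σ_t ψ_t) open the square and sum over t first. For fixed x, y
-- the sum Σ_t χ(g x + t h x) χ(g y + t h y) is a Jacobi sum after an affine change of variables;
-- it equals −χ(h x) χ(h y) + p Z(x,y), where generically Z(x,y) = χ(h x h y)[p ∣ D(x,y)] and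
-- D(x,y) = h x g y − g x h y splits into three linear factors in y. As Σ_x χ(h x) = −1 this gives
-- Σ_t S_t² = −1 + p Σ_{x,y} Z(x,y). Unless p ∣ h x (x² − x + 1) the three factors have distinct
-- roots y, at which χ(h x h y) equals 1, χ(−x) and χ(x − 1); these row sums add up to exactly p,
-- and the at most four remaining rows are bounded by 3. Hence Σ_t S_t² = p² + O(p) and
-- Q(p²,1) = O(1/p).

module Submission where

open import Defs
open import Data.Nat as ℕ using (ℕ; zero; suc; z≤n; s≤s; NonZero)
open import Data.Nat.Primality using (Prime)

module IntegerSums where
  open import Data.Nat as ℕ using (ℕ; zero; suc; z≤n; s≤s)
  open import Data.Nat.Properties using (suc-injective)
  open import Data.Fin using (Fin; toℕ; fromℕ<)
  open import Data.Fin.Properties using (toℕ<n; toℕ-fromℕ<; toℕ-injective)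
  open import Data.Fin.Permutation using (Permutation; permutation)
  open import Data.Integer as ℤ using (ℤ; +_; _+_; _*_; -_; _-_; _≤_; 0ℤ; 1ℤ)
  import Data.Integer.Properties as ℤP
  open import Data.List using (map; upTo; applyUpTo)
  open import Data.Bool using (if_then_else_)
  open import Function using (_∘_; id)
  open import Relation.Binary.PropositionalEquality
  open import Relation.Nullary using (yes; no; ¬_)
  open import Relation.Nullary.Decidable using (⌊_⌋)
  open import Data.Empty using (⊥-elim)
  open import Data.Product using (_×_; _,_; proj₁; proj₂)
  import Algebra.Properties.Semiring.Sum ℤP.+-*-semiring as Fin∑

  Σ : ℕ → (ℕ → ℤ) → ℤ
  Σ n f = Fin∑.sum {n} (f ∘ toℕ)

  sumℤ-upTo : ∀ n (f : ℕ → ℤ) → sumℤ (map f (upTo n)) ≡ Σ n f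
  sumℤ-upTo n f = go n f id
    where
    go : ∀ n (f : ℕ → ℤ) (g : ℕ → ℕ) → sumℤ (map f (applyUpTo g n)) ≡ Σ n (f ∘ g)
    go zero f g = refl
    go (suc n) f g = cong (_+_ (f (g 0))) (go n f (g ∘ suc))

  Σ-cong : ∀ n {f g : ℕ → ℤ} → (∀ i → i ℕ.< n → f i ≡ g i) → Σ n f ≡ Σ n g
  Σ-cong n f≗g = Fin∑.sum-cong-≗ {n} (λ i → f≗g (toℕ i) (toℕ<n i))

  Σ-+ : ∀ n (f g : ℕ → ℤ) → Σ n (λ i → f i + g i) ≡ Σ n f + Σ n g
  Σ-+ n f g = Fin∑.∑-distrib-+ {n} (f ∘ toℕ) (g ∘ toℕ)

  Σ-*ˡ : ∀ n c (f : ℕ → ℤ) → Σ n (λ i → c * f i) ≡ c * Σ n f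
  Σ-*ˡ n c f = sym (Fin∑.*-distribˡ-sum {n} c (f ∘ toℕ))

  Σ-*ʳ : ∀ n (f : ℕ → ℤ) c → Σ n (λ i → f i * c) ≡ Σ n f * c
  Σ-*ʳ n f c = sym (Fin∑.*-distribʳ-sum {n} c (f ∘ toℕ))

  Σ-swap : ∀ m n (F : ℕ → ℕ → ℤ) → Σ m (λ i → Σ n (F i)) ≡ Σ n (λ j → Σ m (λ i → F i j))
  Σ-swap m n F = Fin∑.∑-comm {m} {n} (λ i j → F (toℕ i) (toℕ j))

  Σ-neg : ∀ n (f : ℕ → ℤ) → Σ n (λ i → - f i) ≡ - Σ n f
  Σ-neg zero f = refl
  Σ-neg (suc n) f = trans (cong (_+_ (- f 0)) (Σ-neg n (f ∘ suc))) (sym (ℤP.neg-distrib-+ (f 0) _))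

  Σ-difference : ∀ n (f g : ℕ → ℤ) → Σ n (λ i → f i - g i) ≡ Σ n f - Σ n g
  Σ-difference n f g = trans (Σ-+ n f (λ i → - g i)) (cong (_+_ (Σ n f)) (Σ-neg n g))

  Σ-const : ∀ n c → Σ n (λ _ → c) ≡ + n * c
  Σ-const zero c = refl
  Σ-const (suc n) c = trans (cong (_+_ c) (Σ-const n c)) (sym (ℤP.suc-* (+ n) c))

  Σ-zero : ∀ n → Σ n (λ _ → 0ℤ) ≡ 0ℤ
  Σ-zero n = trans (Σ-const n 0ℤ) (ℤP.*-zeroʳ (+ n))

  Σ-product : ∀ m n (f g : ℕ → ℤ) → Σ m f * Σ n g ≡ Σ m (λ i → Σ n (λ j → f i * g j))
  Σ-product m n f g = begin
    Σ m f * Σ n g                   ≡⟨ sym (Σ-*ʳ m f (Σ n g)) ⟩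
    Σ m (λ i → f i * Σ n g)         ≡⟨ Σ-cong m (λ i _ → sym (Σ-*ˡ n (f i) g)) ⟩
    Σ m (λ i → Σ n (λ j → f i * g j)) ∎
    where open ≡-Reasoning

  Σ-mono-≤ : ∀ n {f g : ℕ → ℤ} → (∀ i → i ℕ.< n → f i ≤ g i) → Σ n f ≤ Σ n g
  Σ-mono-≤ zero f≤g = ℤP.≤-refl
  Σ-mono-≤ (suc n) f≤g = ℤP.+-mono-≤ (f≤g 0 (s≤s z≤n)) (Σ-mono-≤ n (λ i i<n → f≤g (suc i) (s≤s i<n)))

  δ : ℕ → ℕ → ℤ
  δ i a = if ⌊ i ℕ.≟ a ⌋ then 1ℤ else 0ℤ

  δ-refl : ∀ a → δ a a ≡ 1ℤ
  δ-refl a with a ℕ.≟ a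
  ... | yes _ = refl
  ... | no a≢a = ⊥-elim (a≢a refl)

  δ-≢ : ∀ {i a} → ¬ i ≡ a → δ i a ≡ 0ℤ
  δ-≢ {i} {a} i≢a with i ℕ.≟ a
  ... | yes i≡a = ⊥-elim (i≢a i≡a)
  ... | no _ = refl

  Σ-δ : ∀ n {a} → a ℕ.< n → Σ n (λ i → δ i a) ≡ 1ℤ
  Σ-δ (suc n) {zero} _ = cong (_+_ 1ℤ) (trans (Σ-cong n (λ i _ → δ-≢ {suc i} {0} (λ ()))) (Σ-zero n))
  Σ-δ (suc n) {suc a} (s≤s a<n) = begin
    δ 0 (suc a) + Σ n (λ i → δ (suc i) (suc a))  ≡⟨ cong₂ _+_ (δ-≢ {0} {suc a} (λ ())) (Σ-cong n (λ i _ → δ-suc i a)) ⟩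
    0ℤ + Σ n (λ i → δ i a)                        ≡⟨ ℤP.+-identityˡ _ ⟩
    Σ n (λ i → δ i a)                             ≡⟨ Σ-δ n a<n ⟩
    1ℤ                                            ∎
    where
    open ≡-Reasoning
    δ-suc : ∀ i a → δ (suc i) (suc a) ≡ δ i a
    δ-suc i a with i ℕ.≟ a
    ... | yes refl = δ-refl (suc i)
    ... | no i≢a = δ-≢ (i≢a ∘ suc-injective)

  Σ-*δ : ∀ n (f : ℕ → ℤ) {k} → k ℕ.< n → Σ n (λ i → f i * δ i k) ≡ f k
  Σ-*δ n f {k} k<n = begin
    Σ n (λ i → f i * δ i k)   ≡⟨ Σ-cong n (λ i _ → move i) ⟩
    Σ n (λ i → f k * δ i k)   ≡⟨ Σ-*ˡ n (f k) (λ i → δ i k) ⟩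
    f k * Σ n (λ i → δ i k)   ≡⟨ cong (f k *_) (Σ-δ n k<n) ⟩
    f k * 1ℤ                  ≡⟨ ℤP.*-identityʳ (f k) ⟩
    f k                       ∎
    where
    open ≡-Reasoning
    move : ∀ i → f i * δ i k ≡ f k * δ i k
    move i with i ℕ.≟ k
    ... | yes refl = refl
    ... | no _ = trans (ℤP.*-zeroʳ (f i)) (sym (ℤP.*-zeroʳ (f k)))

  nonpos-+≡0 : ∀ {a b} → a ≤ 0ℤ → b ≤ 0ℤ → a + b ≡ 0ℤ → a ≡ 0ℤ × b ≡ 0ℤ
  nonpos-+≡0 {a} {b} a≤0 b≤0 a+b≡0 = a≡0 , trans (sym (ℤP.+-identityˡ b)) (trans (cong (_+ b) (sym a≡0)) a+b≡0)
    where
    open ℤP.≤-Reasoning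
    a≡0 : a ≡ 0ℤ
    a≡0 = ℤP.≤-antisym a≤0 (begin
      0ℤ      ≡⟨ sym a+b≡0 ⟩
      a + b   ≤⟨ ℤP.+-monoʳ-≤ a b≤0 ⟩
      a + 0ℤ  ≡⟨ ℤP.+-identityʳ a ⟩
      a       ∎)

  Σ-nonpos≡0 : ∀ n {f : ℕ → ℤ} → (∀ i → i ℕ.< n → f i ≤ 0ℤ) → Σ n f ≡ 0ℤ → ∀ i → i ℕ.< n → f i ≡ 0ℤ
  Σ-nonpos≡0 (suc n) {f} f≤0 Σf≡0 = λ where
      zero _ → proj₁ split
      (suc i) (s≤s i<n) → Σ-nonpos≡0 n (λ j j<n → f≤0 (suc j) (s≤s j<n)) (proj₂ split) i i<n
    where
    Σtail≤0 : Σ n (f ∘ suc) ≤ 0ℤ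
    Σtail≤0 = ℤP.≤-trans (Σ-mono-≤ n {g = λ _ → 0ℤ} (λ j j<n → f≤0 (suc j) (s≤s j<n))) (ℤP.≤-reflexive (Σ-zero n))
    split : f 0 ≡ 0ℤ × Σ n (f ∘ suc) ≡ 0ℤ
    split = nonpos-+≡0 (f≤0 0 (s≤s z≤n)) Σtail≤0 Σf≡0

  Σ-bijection : ∀ n (f : ℕ → ℤ) (σ τ : ℕ → ℕ) →
                (∀ u → u ℕ.< n → σ u ℕ.< n) → (∀ u → u ℕ.< n → τ u ℕ.< n) →
                (∀ u → u ℕ.< n → τ (σ u) ≡ u) → (∀ u → u ℕ.< n → σ (τ u) ≡ u) →
                Σ n (f ∘ σ) ≡ Σ n f
  Σ-bijection n f σ τ σ< τ< τσ στ = begin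
    Fin∑.sum {n} (f ∘ σ ∘ toℕ)   ≡⟨ Fin∑.sum-cong-≗ {n} (λ i → cong f (sym (toℕ-fromℕ< _))) ⟩
    Fin∑.sum {n} (f ∘ toℕ ∘ σᶠ)  ≡⟨ sym (Fin∑.sum-permute (f ∘ toℕ) π) ⟩
    Fin∑.sum {n} (f ∘ toℕ)       ∎
    where
    open ≡-Reasoning
    σᶠ τᶠ : Fin n → Fin n
    σᶠ i = fromℕ< (σ< (toℕ i) (toℕ<n i))
    τᶠ i = fromℕ< (τ< (toℕ i) (toℕ<n i))
    π : Permutation n n
    π = permutation σᶠ τᶠ
      (λ i → toℕ-injective (trans (toℕ-fromℕ< _) (trans (cong σ (toℕ-fromℕ< _)) (στ (toℕ i) (toℕ<n i)))))
      (λ i → toℕ-injective (trans (toℕ-fromℕ< _) (trans (cong τ (toℕ-fromℕ< _)) (τσ (toℕ i) (toℕ<n i)))))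

module IntegerBounds where
  open import Data.Integer as ℤ using (ℤ; +_; _+_; _*_; -_; _-_; _≤_)
  import Data.Integer.Properties as ℤP
  open import Data.Product using (_×_; _,_; proj₁; proj₂)
  open import Relation.Binary.PropositionalEquality
  open IntegerSums

  Bounded : ℤ → ℤ → Set
  Bounded M z = - M ≤ z × z ≤ M

  Bounded-resp : ∀ {M z w} → z ≡ w → Bounded M z → Bounded M w
  Bounded-resp refl b = b

  Bounded-weaken : ∀ {M N z} → M ≤ N → Bounded M z → Bounded N z
  Bounded-weaken M≤N (-M≤z , z≤M) = ℤP.≤-trans (ℤP.neg-mono-≤ M≤N) -M≤z , ℤP.≤-trans z≤M M≤N

  Bounded-+ : ∀ {M N z w} → Bounded M z → Bounded N w → Bounded (M + N) (z + w)
  Bounded-+ {M} {N} (-M≤z , z≤M) (-N≤w , w≤N) =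
    ℤP.≤-trans (ℤP.≤-reflexive (ℤP.neg-distrib-+ M N)) (ℤP.+-mono-≤ -M≤z -N≤w) , ℤP.+-mono-≤ z≤M w≤N

  Bounded-neg : ∀ {M z} → Bounded M z → Bounded M (- z)
  Bounded-neg {M} (-M≤z , z≤M) = ℤP.neg-mono-≤ z≤M , ℤP.≤-trans (ℤP.neg-mono-≤ -M≤z) (ℤP.≤-reflexive (ℤP.neg-involutive M))

  Bounded-difference : ∀ {M N z w} → Bounded M z → Bounded N w → Bounded (M + N) (z - w)
  Bounded-difference Mz Nw = Bounded-+ Mz (Bounded-neg Nw)

  Bounded-*ˡ : ∀ n {M z} → Bounded M z → Bounded (+ n * M) (+ n * z)
  Bounded-*ˡ n {M} (-M≤z , z≤M) =
    ℤP.≤-trans (ℤP.≤-reflexive (ℤP.neg-distribʳ-* (+ n) M)) (ℤP.*-monoˡ-≤-nonNeg (+ n) -M≤z) , ℤP.*-monoˡ-≤-nonNeg (+ n) z≤M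

  Bounded-Σ : ∀ n {M f : ℕ → ℤ} → (∀ i → i ℕ.< n → Bounded (M i) (f i)) → Bounded (Σ n M) (Σ n f)
  Bounded-Σ n {M} {f} bounded =
    ℤP.≤-trans (ℤP.≤-reflexive (sym (Σ-neg n M))) (Σ-mono-≤ n (λ i i<n → proj₁ (bounded i i<n))) ,
    Σ-mono-≤ n (λ i i<n → proj₂ (bounded i i<n))

module IntegersInRationals where
  open import Data.Nat as ℕ using (ℕ; zero; suc; z≤n; NonZero)
  open import Data.Integer as ℤ using (ℤ; +_)
  open import Data.Integer.GCD using (gcd)
  import Data.Integer.Properties as ℤP
  open import Data.Integer.Tactic.RingSolver using (solve-∀)
  open import Data.Rational as ℚ using (ℚ; _/_; toℚᵘ; ↥_; ↧_; 0ℚ; 1ℚ; _+_; _*_; -_; _-_; _≤_; ∣_∣)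
  import Data.Rational.Properties as ℚP
  open import Data.Rational.Unnormalised as ℚᵘ using (mkℚᵘ; *≡*; *≤*)
  import Data.Rational.Unnormalised.Properties as ℚᵘP
  open import Data.List using (List; []; _∷_; map; upTo)
  open import Data.List.Properties using (map-cong)
  open import Data.Sum using (inj₁; inj₂)
  open import Function using (_∘_)
  open import Relation.Binary.PropositionalEquality
  import Algebra.Properties.Group ℚP.+-0-group as +-Group
  open import Data.Maybe using (nothing)
  open import Data.Product using (_,_)
  open import Tactic.RingSolver.Core.AlmostCommutativeRing using (AlmostCommutativeRing; fromCommutativeRing)
  open IntegerBounds using (Bounded)

  ℚ-ring : AlmostCommutativeRing _ _
  ℚ-ring = fromCommutativeRing ℚP.+-*-commutativeRing (λ _ → nothing)

  fromℤ : ℤ → ℚ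
  fromℤ z = z / 1

  toℚᵘ-/ : ∀ i n → toℚᵘ (i / suc n) ℚᵘ.≃ mkℚᵘ i n
  toℚᵘ-/ i n = *≡* (begin
    ℚᵘ.↥ toℚᵘ q ℤ.* + suc n  ≡⟨ cong (ℤ._* + suc n) (ℚP.↥ᵘ-toℚᵘ q) ⟩
    ↥ q ℤ.* + suc n          ≡⟨ cong (ℤ._*_ (↥ q)) (sym (ℚP.↧-/ i (suc n))) ⟩
    ↥ q ℤ.* (↧ q ℤ.* g)      ≡⟨ regroup (↥ q) (↧ q) g ⟩
    (↥ q ℤ.* g) ℤ.* ↧ q      ≡⟨ cong (ℤ._* ↧ q) (ℚP.↥-/ i (suc n)) ⟩
    i ℤ.* ↧ q                ≡⟨ cong (ℤ._*_ i) (ℚP.↧ᵘ-toℚᵘ q) ⟨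
    i ℤ.* ℚᵘ.↧ toℚᵘ q        ∎)
    where
    open ≡-Reasoning
    q : ℚ
    q = i / suc n
    g : ℤ
    g = gcd i (+ suc n)
    regroup : ∀ a b c → a ℤ.* (b ℤ.* c) ≡ (a ℤ.* c) ℤ.* b
    regroup = solve-∀

  fromℤ-+ : ∀ a b → fromℤ (a ℤ.+ b) ≡ fromℤ a + fromℤ b
  fromℤ-+ a b = ℚP.toℚᵘ-injective (begin
    toℚᵘ (fromℤ (a ℤ.+ b))                 ≈⟨ toℚᵘ-/ (a ℤ.+ b) 0 ⟩
    mkℚᵘ (a ℤ.+ b) 0                       ≈⟨ *≡* (expand a b) ⟩
    mkℚᵘ a 0 ℚᵘ.+ mkℚᵘ b 0                 ≈⟨ ℚᵘP.+-cong (toℚᵘ-/ a 0) (toℚᵘ-/ b 0) ⟨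
    toℚᵘ (fromℤ a) ℚᵘ.+ toℚᵘ (fromℤ b)     ≈⟨ ℚP.toℚᵘ-homo-+ (fromℤ a) (fromℤ b) ⟨
    toℚᵘ (fromℤ a + fromℤ b)               ∎)
    where
    open ℚᵘP.≃-Reasoning
    expand : ∀ a b → (a ℤ.+ b) ℤ.* + 1 ≡ (a ℤ.* + 1 ℤ.+ b ℤ.* + 1) ℤ.* + 1
    expand = solve-∀

  fromℤ-* : ∀ a b → fromℤ (a ℤ.* b) ≡ fromℤ a * fromℤ b
  fromℤ-* a b = ℚP.toℚᵘ-injective (begin
    toℚᵘ (fromℤ (a ℤ.* b))                 ≈⟨ toℚᵘ-/ (a ℤ.* b) 0 ⟩
    mkℚᵘ (a ℤ.* b) 0                       ≈⟨ ℚᵘP.*-cong (toℚᵘ-/ a 0) (toℚᵘ-/ b 0) ⟨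
    toℚᵘ (fromℤ a) ℚᵘ.* toℚᵘ (fromℤ b)     ≈⟨ ℚP.toℚᵘ-homo-* (fromℤ a) (fromℤ b) ⟨
    toℚᵘ (fromℤ a * fromℤ b)               ∎)
    where open ℚᵘP.≃-Reasoning

  fromℤ-neg : ∀ a → fromℤ (ℤ.- a) ≡ - fromℤ a
  fromℤ-neg a = ℚP.toℚᵘ-injective (begin
    toℚᵘ (fromℤ (ℤ.- a))     ≈⟨ toℚᵘ-/ (ℤ.- a) 0 ⟩
    mkℚᵘ (ℤ.- a) 0           ≈⟨ ℚᵘP.-‿cong (toℚᵘ-/ a 0) ⟨
    ℚᵘ.- toℚᵘ (fromℤ a)      ≈⟨ ℚP.toℚᵘ-homo‿- (fromℤ a) ⟨
    toℚᵘ (- fromℤ a)         ∎)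
    where open ℚᵘP.≃-Reasoning

  fromℤ-difference : ∀ a b → fromℤ (a ℤ.- b) ≡ fromℤ a - fromℤ b
  fromℤ-difference a b = trans (fromℤ-+ a (ℤ.- b)) (cong (_+_ (fromℤ a)) (fromℤ-neg b))

  fromℤ-mono-≤ : ∀ {a b} → a ℤ.≤ b → fromℤ a ≤ fromℤ b
  fromℤ-mono-≤ {a} {b} a≤b = ℚP.toℚᵘ-cancel-≤ (begin
    toℚᵘ (fromℤ a)   ≃⟨ toℚᵘ-/ a 0 ⟩
    mkℚᵘ a 0         ≤⟨ *≤* (ℤP.*-monoʳ-≤-nonNeg (+ 1) a≤b) ⟩
    mkℚᵘ b 0         ≃⟨ toℚᵘ-/ b 0 ⟨
    toℚᵘ (fromℤ b)   ∎)
    where open ℚᵘP.≤-Reasoning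

  fromℤ-p*inv-p≡1 : ∀ p .{{_ : NonZero p}} → fromℤ (+ p) * inv p ≡ 1ℚ
  fromℤ-p*inv-p≡1 (suc k) = ℚP.toℚᵘ-injective (begin
    toℚᵘ (fromℤ (+ suc k) * inv (suc k))               ≈⟨ ℚP.toℚᵘ-homo-* (fromℤ (+ suc k)) (inv (suc k)) ⟩
    toℚᵘ (fromℤ (+ suc k)) ℚᵘ.* toℚᵘ (inv (suc k))     ≈⟨ ℚᵘP.*-cong (toℚᵘ-/ (+ suc k) 0) (toℚᵘ-/ (+ 1) k) ⟩
    mkℚᵘ (+ suc k) 0 ℚᵘ.* mkℚᵘ (+ 1) k                 ≈⟨ *≡* p*1≡1*p ⟩
    ℚᵘ.1ℚᵘ                                             ∎)
    where
    open ℚᵘP.≃-Reasoning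
    p*1≡1*p : (+ suc k ℤ.* + 1) ℤ.* + 1 ≡ + 1 ℤ.* (+ 1 ℤ.* + suc k)
    p*1≡1*p = trans (ℤP.*-identityʳ (+ suc k ℤ.* + 1)) (trans (ℤP.*-identityʳ (+ suc k)) (sym (trans (ℤP.*-identityˡ (+ 1 ℤ.* + suc k)) (ℤP.*-identityˡ (+ suc k)))))

  0≤inv : ∀ p → 0ℚ ≤ inv p
  0≤inv zero = ℚP.≤-refl
  0≤inv (suc k) = ℚP.toℚᵘ-cancel-≤ (ℚᵘP.≤-respʳ-≃ (ℚᵘP.≃-sym (toℚᵘ-/ (+ 1) k)) (*≤* (ℤ.+≤+ z≤n)))

  sumℚ-fromℤ : ∀ n (f : ℕ → ℤ) → sumℚ (map (fromℤ ∘ f) (upTo n)) ≡ fromℤ (sumℤ (map f (upTo n)))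
  sumℚ-fromℤ n f = go (upTo n)
    where
    go : ∀ xs → sumℚ (map (fromℤ ∘ f) xs) ≡ fromℤ (sumℤ (map f xs))
    go [] = refl
    go (x ∷ xs) = trans (cong (_+_ (fromℤ (f x))) (go xs)) (sym (fromℤ-+ (f x) _))

  sumℚ-cong : ∀ (xs : List ℕ) {f g : ℕ → ℚ} → (∀ x → f x ≡ g x) → sumℚ (map f xs) ≡ sumℚ (map g xs)
  sumℚ-cong xs f≗g = cong sumℚ (map-cong f≗g xs)

  sumℚ-*ʳ : ∀ (xs : List ℕ) (f : ℕ → ℚ) c → sumℚ (map (λ x → f x * c) xs) ≡ sumℚ (map f xs) * c
  sumℚ-*ʳ [] f c = sym (ℚP.*-zeroˡ c)
  sumℚ-*ʳ (x ∷ xs) f c = trans (cong (_+_ (f x * c)) (sumℚ-*ʳ xs f c)) (sym (ℚP.*-distribʳ-+ c (f x) _))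

  -y≤x≤y⇒∣x∣≤y : ∀ {x y} → - y ≤ x → x ≤ y → ∣ x ∣ ≤ y
  -y≤x≤y⇒∣x∣≤y {x} {y} -y≤x x≤y with ℚP.∣p∣≡p∨∣p∣≡-p x
  ... | inj₁ ∣x∣≡x = ℚP.≤-trans (ℚP.≤-reflexive ∣x∣≡x) x≤y
  ... | inj₂ ∣x∣≡-x = ℚP.≤-trans (ℚP.≤-reflexive ∣x∣≡-x)
                        (ℚP.≤-trans (ℚP.neg-antimono-≤ -y≤x) (ℚP.≤-reflexive (+-Group.⁻¹-involutive y)))

  ∣fromℤ*∣≤ : ∀ {M z} q → 0ℚ ≤ q → Bounded M z → ∣ fromℤ z * q ∣ ≤ fromℤ M * q
  ∣fromℤ*∣≤ {M} {z} q 0≤q (-M≤z , z≤M) = begin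
    ∣ fromℤ z * q ∣        ≡⟨ ℚP.∣p*q∣≡∣p∣*∣q∣ (fromℤ z) q ⟩
    ∣ fromℤ z ∣ * ∣ q ∣    ≡⟨ cong (∣ fromℤ z ∣ *_) (ℚP.0≤p⇒∣p∣≡p 0≤q) ⟩
    ∣ fromℤ z ∣ * q        ≤⟨ ℚP.*-monoʳ-≤-nonNeg q {{ℚ.nonNegative 0≤q}} ∣z∣≤M ⟩
    fromℤ M * q            ∎
    where
    open ℚP.≤-Reasoning
    ∣z∣≤M : ∣ fromℤ z ∣ ≤ fromℤ M
    ∣z∣≤M = -y≤x≤y⇒∣x∣≤y (ℚP.≤-trans (ℚP.≤-reflexive (sym (fromℤ-neg M))) (fromℤ-mono-≤ -M≤z)) (fromℤ-mono-≤ z≤M)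

module LegendreSymbol where
  open import Data.Integer using (+_; -_)
  open import Data.Integer.DivMod using (_%ℕ_)
  import Data.Nat.Properties as ℕP
  open import Data.Bool using (Bool; if_then_else_; T)
  open import Data.Bool.ListAction using (any)
  open import Data.List using (upTo)
  open import Data.List.Relation.Unary.Any.Properties using (any⁺; any⁻)
  open import Data.List.Membership.Propositional using (find; lose)
  open import Data.List.Membership.Propositional.Properties using (∈-upTo⁺; ∈-upTo⁻)
  open import Data.Product using (∃-syntax; _×_; _,_)
  open import Data.Empty using (⊥-elim)
  open import Relation.Binary.PropositionalEquality
  open import Relation.Nullary using (¬_; yes; no)
  open import Function using (_∘_)

  squareTest : (n : ℕ) → .{{NonZero n}} → ℕ → Bool
  squareTest n r = any (λ x → ((x ℕ.* x) ℕ.% n) ℕ.≡ᵇ r) (upTo n)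

  squareTest-sound : ∀ n .{{_ : NonZero n}} r → T (squareTest n r) → ∃[ x ] x ℕ.< n × (x ℕ.* x) ℕ.% n ≡ r
  squareTest-sound n r t with find (any⁻ _ (upTo n) t)
  ... | x , x∈ , x²≡r = x , ∈-upTo⁻ x∈ , ℕP.≡ᵇ⇒≡ _ r x²≡r

  squareTest-complete : ∀ n .{{_ : NonZero n}} {r} x → x ℕ.< n → (x ℕ.* x) ℕ.% n ≡ r → T (squareTest n r)
  squareTest-complete n {r} x x<n x²≡r = any⁺ _ (lose (∈-upTo⁺ x<n) (ℕP.≡⇒≡ᵇ _ r x²≡r))

  legendre-divisible : ∀ n .{{_ : NonZero n}} a → a %ℕ n ≡ 0 → legendre n a ≡ + 0
  legendre-divisible (suc k) a a%n≡0 with a %ℕ suc k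
  ... | zero = refl
  ... | suc _ = ⊥-elim (ℕP.1+n≢0 a%n≡0)

  legendre-indivisible : ∀ n .{{_ : NonZero n}} a → ¬ a %ℕ n ≡ 0 →
                         legendre n a ≡ (if squareTest n (a %ℕ n) then + 1 else - + 1)
  legendre-indivisible (suc k) a a%n≢0 with a %ℕ suc k
  ... | zero = ⊥-elim (a%n≢0 refl)
  ... | suc _ = refl

  legendre-cong-%ℕ : ∀ n .{{_ : NonZero n}} {a b} → a %ℕ n ≡ b %ℕ n → legendre n a ≡ legendre n b
  legendre-cong-%ℕ n {a} {b} a≡b with a %ℕ n ℕ.≟ 0
  ... | yes a≡0 = trans (legendre-divisible n a a≡0) (sym (legendre-divisible n b (trans (sym a≡b) a≡0)))
  ... | no a≢0 = begin
    legendre n a                                              ≡⟨ legendre-indivisible n a a≢0 ⟩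
    (if squareTest n (a %ℕ n) then + 1 else - + 1)            ≡⟨ cong (λ r → if squareTest n r then + 1 else - + 1) a≡b ⟩
    (if squareTest n (b %ℕ n) then + 1 else - + 1)            ≡⟨ legendre-indivisible n b (a≢0 ∘ trans a≡b) ⟨
    legendre n b                                              ∎
    where open ≡-Reasoning

module PrimeField (p : ℕ) (p-prime : Prime p) (2<p : 2 ℕ.< p) where
  import Data.Nat.Properties as ℕP
  import Data.Nat.Divisibility as ℕD
  import Data.Nat.DivMod as ℕDM
  open import Data.Nat.Primality using (euclidsLemma)
  open import Data.Nat.Coprimality using (prime⇒coprime; coprime-Bézout)
  open import Data.Nat.GCD using (module Bézout)
  open import Data.Integer as ℤ using (ℤ; +_; _+_; _*_; -_; _-_; _≤_; 0ℤ; 1ℤ; -1ℤ)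
  import Data.Integer.Properties as ℤP
  open import Data.Integer.DivMod using (_%ℕ_; _/ℕ_; a≡a%ℕn+[a/ℕn]*n; n%ℕd<d)
  open import Data.Integer.Divisibility.Signed as ℤD using (_∣_; divides; _∣?_)
  open import Data.Integer.Tactic.RingSolver using (solve-∀; solve)
  import Data.Rational as ℚ
  import Data.Rational.Properties as ℚP
  import Tactic.RingSolver as RingSolver
  open import Data.Bool using (true; false; if_then_else_; T)
  open import Data.List using ([]; _∷_; map; upTo)
  open import Data.Product using (∃-syntax; _×_; _,_; proj₁; proj₂)
  open import Data.Sum using (_⊎_; inj₁; inj₂; [_,_]; [_,_]′; reduce)
  open import Data.Empty using (⊥-elim)
  open import Function using (_∘_; id)
  open import Relation.Binary.PropositionalEquality hiding ([_])
  open import Relation.Binary.Bundles using (Setoid)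
  open import Relation.Binary.Structures using (IsEquivalence)
  import Relation.Binary.Reasoning.Setoid
  open import Relation.Nullary using (Dec; does; yes; no; ¬_; contradiction)
  open import Relation.Nullary.Decidable using (T?; map′; dec-true; dec-false; isYes≗does)
  open IntegerSums
  open IntegerBounds
  open IntegersInRationals
  open LegendreSymbol

  0<p : 0 ℕ.< p
  0<p = ℕP.<-trans (s≤s z≤n) 2<p

  instance
    p≢0 : NonZero p
    p≢0 = ℕ.>-nonZero 0<p

  -- Congruences modulo p

  P : ℤ
  P = + p

  infix 4 _≋_
  record _≋_ (a b : ℤ) : Set where
    constructor mk≋
    field ≋⇒P∣- : P ∣ a - b
  open _≋_ public

  P∣0 : P ∣ 0ℤ
  P∣0 = divides 0ℤ refl

  P∣-resp : ∀ {a b} → P ∣ a → a ≡ b → P ∣ b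
  P∣-resp P∣a refl = P∣a

  ≋-refl : ∀ {a} → a ≋ a
  ≋-refl {a} = mk≋ (P∣-resp P∣0 (sym (ℤP.+-inverseʳ a)))

  ≡⇒≋ : ∀ {a b} → a ≡ b → a ≋ b
  ≡⇒≋ refl = ≋-refl

  ≋-sym : ∀ {a b} → a ≋ b → b ≋ a
  ≋-sym {a} {b} (mk≋ P∣a-b) = mk≋ (P∣-resp (ℤD.∣m⇒∣-m P∣a-b) (solve (a ∷ b ∷ [])))

  ≋-trans : ∀ {a b c} → a ≋ b → b ≋ c → a ≋ c
  ≋-trans {a} {b} {c} (mk≋ P∣a-b) (mk≋ P∣b-c) = mk≋ (P∣-resp (ℤD.∣m∣n⇒∣m+n P∣a-b P∣b-c) (solve (a ∷ b ∷ c ∷ [])))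

  ≋-isEquivalence : IsEquivalence _≋_
  ≋-isEquivalence = record { refl = ≋-refl ; sym = ≋-sym ; trans = ≋-trans }

  ≋-setoid : Setoid _ _
  ≋-setoid = record { isEquivalence = ≋-isEquivalence }

  module ≋-Reasoning = Relation.Binary.Reasoning.Setoid ≋-setoid

  ≋-+ : ∀ {a b c d} → a ≋ b → c ≋ d → a + c ≋ b + d
  ≋-+ {a} {b} {c} {d} (mk≋ x) (mk≋ y) = mk≋ (P∣-resp (ℤD.∣m∣n⇒∣m+n x y) (solve (a ∷ b ∷ c ∷ d ∷ [])))

  ≋-neg : ∀ {a b} → a ≋ b → - a ≋ - b
  ≋-neg {a} {b} (mk≋ x) = mk≋ (P∣-resp (ℤD.∣m⇒∣-m x) (solve (a ∷ b ∷ [])))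

  ≋-* : ∀ {a b c d} → a ≋ b → c ≋ d → a * c ≋ b * d
  ≋-* {a} {b} {c} {d} (mk≋ x) (mk≋ y) =
    mk≋ (P∣-resp (ℤD.∣m∣n⇒∣m+n (ℤD.∣m⇒∣m*n c x) (ℤD.∣n⇒∣m*n b y)) (solve (a ∷ b ∷ c ∷ d ∷ [])))

  P∣-resp-≋ : ∀ {a b} → P ∣ a → a ≋ b → P ∣ b
  P∣-resp-≋ {a} {b} P∣a (mk≋ x) = P∣-resp (ℤD.∣m∣n⇒∣m-n P∣a x) (solve (a ∷ b ∷ []))

  P∣⇒≋0 : ∀ {a} → P ∣ a → a ≋ 0ℤ
  P∣⇒≋0 {a} P∣a = mk≋ (P∣-resp P∣a (sym (ℤP.+-identityʳ a)))

  ≋0⇒P∣ : ∀ {a} → a ≋ 0ℤ → P ∣ a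
  ≋0⇒P∣ {a} (mk≋ x) = P∣-resp x (ℤP.+-identityʳ a)

  ≋-%ℕ : ∀ a → a ≋ + (a %ℕ p)
  ≋-%ℕ a = mk≋ (divides (a /ℕ p) (begin
    a - + (a %ℕ p)                          ≡⟨ cong (_- + (a %ℕ p)) (a≡a%ℕn+[a/ℕn]*n a p) ⟩
    + (a %ℕ p) + a /ℕ p * P - + (a %ℕ p)    ≡⟨ cancel (+ (a %ℕ p)) (a /ℕ p * P) ⟩
    a /ℕ p * P                              ∎))
    where
    open ≡-Reasoning
    cancel : ∀ r q → r + q - r ≡ q
    cancel = solve-∀

  %ℕ<p : ∀ a → a %ℕ p ℕ.< p
  %ℕ<p a = n%ℕd<d a p

  P∣-small⇒0 : ∀ d → ℤ.∣ d ∣ ℕ.< p → P ∣ d → d ≡ 0ℤ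
  P∣-small⇒0 d ∣d∣<p P∣d with ℤ.∣ d ∣ in ∣d∣≡
  ... | zero = ℤP.∣i∣≡0⇒i≡0 ∣d∣≡
  ... | suc m = ⊥-elim (ℕP.<⇒≱ ∣d∣<p (ℕD.∣⇒≤ (subst (p ℕD.∣_) ∣d∣≡ (ℤD.∣⇒∣ᵤ P∣d))))

  ≋-<p⇒≡ : ∀ {r s} → r ℕ.< p → s ℕ.< p → + r ≋ + s → r ≡ s
  ≋-<p⇒≡ {r} {s} r<p s<p (mk≋ P∣r-s) = ℤP.+-injective (ℤP.i-j≡0⇒i≡j (+ r) (+ s) (P∣-small⇒0 (+ r - + s) ∣r-s∣<p P∣r-s))
    where
    ∣r-s∣<p : ℤ.∣ + r - + s ∣ ℕ.< p
    ∣r-s∣<p = subst (λ z → ℤ.∣ z ∣ ℕ.< p) (sym (ℤP.m-n≡m⊖n r s))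
                (ℕP.≤-<-trans (ℤP.∣m⊝n∣≤m⊔n r s) (ℕP.⊔-pres-<m r<p s<p))

  ≋⇒%ℕ≡ : ∀ {a b} → a ≋ b → a %ℕ p ≡ b %ℕ p
  ≋⇒%ℕ≡ {a} {b} a≋b = ≋-<p⇒≡ (%ℕ<p a) (%ℕ<p b) (≋-trans (≋-sym (≋-%ℕ a)) (≋-trans a≋b (≋-%ℕ b)))

  %ℕ-<p : ∀ {r} → r ℕ.< p → (+ r) %ℕ p ≡ r
  %ℕ-<p r<p = ℕDM.m<n⇒m%n≡m r<p

  %ℕ≡0⇒P∣ : ∀ {a} → a %ℕ p ≡ 0 → P ∣ a
  %ℕ≡0⇒P∣ {a} a%p≡0 = ≋0⇒P∣ (subst (λ r → a ≋ + r) a%p≡0 (≋-%ℕ a))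

  P∣⇒%ℕ≡0 : ∀ {a} → P ∣ a → a %ℕ p ≡ 0
  P∣⇒%ℕ≡0 P∣a = trans (≋⇒%ℕ≡ (P∣⇒≋0 P∣a)) (%ℕ-<p 0<p)

  P∣-<p⇒0 : ∀ {r} → r ℕ.< p → P ∣ + r → r ≡ 0
  P∣-<p⇒0 r<p P∣r = ≋-<p⇒≡ r<p 0<p (P∣⇒≋0 P∣r)

  P∣*⇒ : ∀ {a b} → P ∣ a * b → (P ∣ a) ⊎ (P ∣ b)
  P∣*⇒ {a} {b} P∣ab with euclidsLemma ℤ.∣ a ∣ ℤ.∣ b ∣ p-prime (subst (p ℕD.∣_) (ℤP.abs-* a b) (ℤD.∣⇒∣ᵤ P∣ab))
  ... | inj₁ p∣a = inj₁ (ℤD.∣ᵤ⇒∣ p∣a)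
  ... | inj₂ p∣b = inj₂ (ℤD.∣ᵤ⇒∣ p∣b)

  ∤*∤ : ∀ {a b} → ¬ P ∣ a → ¬ P ∣ b → ¬ P ∣ a * b
  ∤*∤ P∤a P∤b P∣ab = [ P∤a , P∤b ] (P∣*⇒ P∣ab)

  P∤<p : ∀ {n} → 0 ℕ.< n → n ℕ.< p → ¬ P ∣ + n
  P∤<p 0<n n<p P∣n = ℕP.<⇒≢ 0<n (sym (P∣-<p⇒0 n<p P∣n))

  P∤1 : ¬ P ∣ 1ℤ
  P∤1 = P∤<p (s≤s z≤n) (ℕP.<-trans (s≤s (s≤s z≤n)) 2<p)

  P∤2 : ¬ P ∣ + 2
  P∤2 = P∤<p (s≤s z≤n) 2<p

  P∤-1 : ¬ P ∣ -1ℤ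
  P∤-1 = P∤1 ∘ ℤD.∣m⇒∣-m

  *-cancelˡ-≋ : ∀ {a b c} → ¬ P ∣ c → c * a ≋ c * b → a ≋ b
  *-cancelˡ-≋ {a} {b} {c} P∤c (mk≋ P∣ca-cb) with P∣*⇒ {c} {a - b} (P∣-resp P∣ca-cb (solve (c ∷ a ∷ b ∷ [])))
  ... | inj₁ P∣c = ⊥-elim (P∤c P∣c)
  ... | inj₂ P∣a-b = mk≋ P∣a-b

  residue-inverse : ∀ {r} → 0 ℕ.< r → r ℕ.< p → ∃[ s ] + r * s ≋ 1ℤ
  residue-inverse {r} 0<r r<p with coprime-Bézout (prime⇒coprime p-prime {{ℕ.>-nonZero 0<r}} r<p)
  ... | Bézout.+- x y 1+yr≡xp = - + y , mk≋ (divides (- + x) (begin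
    + r * - + y - 1ℤ      ≡⟨ regroup (+ r) (+ y) ⟩
    - (1ℤ + + y * + r)    ≡⟨ cong -_ (trans (cong (_+_ 1ℤ) (sym (ℤP.pos-* y r))) (trans (cong +_ 1+yr≡xp) (ℤP.pos-* x p))) ⟩
    - (+ x * P)           ≡⟨ ℤP.neg-distribˡ-* (+ x) P ⟩
    - + x * P             ∎))
    where
    open ≡-Reasoning
    regroup : ∀ r y → r * - y - 1ℤ ≡ - (1ℤ + y * r)
    regroup = solve-∀
  ... | Bézout.-+ x y 1+xp≡yr = + y , mk≋ (divides (+ x) (begin
    + r * + y - 1ℤ        ≡⟨ cong (_- 1ℤ) (ℤP.*-comm (+ r) (+ y)) ⟩
    + y * + r - 1ℤ        ≡⟨ cong (_- 1ℤ) (trans (sym (ℤP.pos-* y r)) (trans (cong +_ (sym 1+xp≡yr)) (cong (_+_ 1ℤ) (ℤP.pos-* x p)))) ⟩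
    1ℤ + + x * P - 1ℤ     ≡⟨ cancel (+ x * P) ⟩
    + x * P               ∎))
    where
    open ≡-Reasoning
    cancel : ∀ q → 1ℤ + q - 1ℤ ≡ q
    cancel = solve-∀

  invertible : ∀ a → ¬ P ∣ a → ∃[ b ] a * b ≋ 1ℤ
  invertible a P∤a with a %ℕ p in a%p≡
  ... | zero = ⊥-elim (P∤a (%ℕ≡0⇒P∣ a%p≡))
  ... | suc m with residue-inverse (s≤s z≤n) (subst (ℕ._< p) a%p≡ (%ℕ<p a))
  ...   | s , rs≋1 = s , ≋-trans (≋-* (subst (λ r → a ≋ + r) a%p≡ (≋-%ℕ a)) ≋-refl) rs≋1

  infix 8 _⁻¹
  _⁻¹ : ℤ → ℤ
  a ⁻¹ with P ∣? a
  ... | yes _ = 0ℤ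
  ... | no P∤a = proj₁ (invertible a P∤a)

  *-inverseʳ : ∀ a → ¬ P ∣ a → a * a ⁻¹ ≋ 1ℤ
  *-inverseʳ a P∤a with P ∣? a
  ... | yes P∣a = ⊥-elim (P∤a P∣a)
  ... | no P∤a′ = proj₂ (invertible a P∤a′)

  ⁻¹-P∣ : ∀ {a} → P ∣ a → a ⁻¹ ≡ 0ℤ
  ⁻¹-P∣ {a} P∣a with P ∣? a
  ... | yes _ = refl
  ... | no P∤a = ⊥-elim (P∤a P∣a)

  *≋1⇒P∤ : ∀ {a b} → a * b ≋ 1ℤ → ¬ P ∣ a
  *≋1⇒P∤ {a} {b} ab≋1 P∣a = P∤1 (P∣-resp-≋ (ℤD.∣m⇒∣m*n b P∣a) ab≋1)

  ⁻¹-unique : ∀ {a b} → a * b ≋ 1ℤ → a ⁻¹ ≋ b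
  ⁻¹-unique {a} {b} ab≋1 = *-cancelˡ-≋ {a ⁻¹} {b} {a} (*≋1⇒P∤ ab≋1) (≋-trans (*-inverseʳ a (*≋1⇒P∤ ab≋1)) (≋-sym ab≋1))

  -- The Legendre symbol

  χ : ℤ → ℤ
  χ = legendre p

  χ-≋ : ∀ {a b} → a ≋ b → χ a ≡ χ b
  χ-≋ a≋b = legendre-cong-%ℕ p (≋⇒%ℕ≡ a≋b)

  IsSquare : ℤ → Set
  IsSquare a = ∃[ y ] a ≋ y * y

  IsSquare-≋ : ∀ {a b} → a ≋ b → IsSquare a → IsSquare b
  IsSquare-≋ a≋b (y , a≋y²) = y , ≋-trans (≋-sym a≋b) a≋y²

  P∤-square-root : ∀ {a y} → ¬ P ∣ a → a ≋ y * y → ¬ P ∣ y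
  P∤-square-root {a} {y} P∤a a≋y² P∣y = P∤a (P∣-resp-≋ (ℤD.∣m⇒∣m*n y P∣y) (≋-sym a≋y²))

  square⇒squareTest : ∀ {a} → IsSquare a → T (squareTest p (a %ℕ p))
  square⇒squareTest {a} (y , a≋y²) = squareTest-complete p (y %ℕ p) (%ℕ<p y) (≋⇒%ℕ≡ (begin
    + ((y %ℕ p) ℕ.* (y %ℕ p))      ≡⟨ ℤP.pos-* (y %ℕ p) (y %ℕ p) ⟩
    + (y %ℕ p) * + (y %ℕ p)        ≈⟨ ≋-* (≋-%ℕ y) (≋-%ℕ y) ⟨
    y * y                          ≈⟨ a≋y² ⟨
    a                              ∎))
    where open ≋-Reasoning

  squareTest⇒square : ∀ {a} → T (squareTest p (a %ℕ p)) → IsSquare a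
  squareTest⇒square {a} t with squareTest-sound p (a %ℕ p) t
  ... | x , _ , x²%p≡a%p = + x , (begin
    a                       ≈⟨ ≋-%ℕ a ⟩
    + (a %ℕ p)              ≡⟨ cong +_ x²%p≡a%p ⟨
    + ((+ (x ℕ.* x)) %ℕ p)   ≈⟨ ≋-%ℕ (+ (x ℕ.* x)) ⟨
    + (x ℕ.* x)             ≡⟨ ℤP.pos-* x x ⟩
    + x * + x               ∎)
    where open ≋-Reasoning

  isSquare? : ∀ a → Dec (IsSquare a)
  isSquare? a = map′ squareTest⇒square square⇒squareTest (T? (squareTest p (a %ℕ p)))

  data Residuosity (a : ℤ) : Set where
    divisible  : P ∣ a → Residuosity a
    residue    : ¬ P ∣ a → IsSquare a → Residuosity a
    nonresidue : ¬ P ∣ a → ¬ IsSquare a → Residuosity a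

  residuosity : ∀ a → Residuosity a
  residuosity a with P ∣? a | isSquare? a
  ... | yes P∣a | _ = divisible P∣a
  ... | no P∤a | yes a□ = residue P∤a a□
  ... | no P∤a | no ¬a□ = nonresidue P∤a ¬a□

  χ-divisible : ∀ {a} → P ∣ a → χ a ≡ 0ℤ
  χ-divisible {a} P∣a = legendre-divisible p a (P∣⇒%ℕ≡0 P∣a)

  χ-indivisible : ∀ {a} → ¬ P ∣ a → χ a ≡ (if squareTest p (a %ℕ p) then 1ℤ else -1ℤ)
  χ-indivisible {a} P∤a = legendre-indivisible p a (P∤a ∘ %ℕ≡0⇒P∣)

  χ-residue : ∀ {a} → ¬ P ∣ a → IsSquare a → χ a ≡ 1ℤ
  χ-residue {a} P∤a a□ = trans (χ-indivisible P∤a) (if-T (square⇒squareTest a□))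
    where
    if-T : ∀ {b} → T b → (if b then 1ℤ else -1ℤ) ≡ 1ℤ
    if-T {true} _ = refl

  χ-nonresidue : ∀ {a} → ¬ P ∣ a → ¬ IsSquare a → χ a ≡ -1ℤ
  χ-nonresidue {a} P∤a ¬a□ = trans (χ-indivisible P∤a) (if-¬T (¬a□ ∘ squareTest⇒square))
    where
    if-¬T : ∀ {b} → ¬ T b → (if b then 1ℤ else -1ℤ) ≡ -1ℤ
    if-¬T {false} _ = refl
    if-¬T {true} ¬t = ⊥-elim (¬t _)

  -- Character sums

  [p∣_] : ℤ → ℤ
  [p∣ z ] = if does (P ∣? z) then 1ℤ else 0ℤ

  [p∣]-yes : ∀ {z} → P ∣ z → [p∣ z ] ≡ 1ℤ
  [p∣]-yes {z} P∣z = cong (λ b → if b then 1ℤ else 0ℤ) (dec-true (P ∣? z) P∣z)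

  [p∣]-no : ∀ {z} → ¬ P ∣ z → [p∣ z ] ≡ 0ℤ
  [p∣]-no {z} P∤z = cong (λ b → if b then 1ℤ else 0ℤ) (dec-false (P ∣? z) P∤z)

  [p∣]-⇔ : ∀ {a b} → (P ∣ a → P ∣ b) → (P ∣ b → P ∣ a) → [p∣ a ] ≡ [p∣ b ]
  [p∣]-⇔ {a} {b} a⇒b b⇒a = case (P ∣? b)
    where
    case : Dec (P ∣ b) → [p∣ a ] ≡ [p∣ b ]
    case (yes P∣b) = trans ([p∣]-yes (b⇒a P∣b)) (sym ([p∣]-yes P∣b))
    case (no P∤b) = trans ([p∣]-no (P∤b ∘ a⇒b)) (sym ([p∣]-no P∤b))

  [p∣]-≋ : ∀ {a b} → a ≋ b → [p∣ a ] ≡ [p∣ b ]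
  [p∣]-≋ a≋b = [p∣]-⇔ (λ P∣a → P∣-resp-≋ P∣a a≋b) (λ P∣b → P∣-resp-≋ P∣b (≋-sym a≋b))

  [p∣-]-comm : ∀ a b → [p∣ a - b ] ≡ [p∣ b - a ]
  [p∣-]-comm a b = [p∣]-⇔ (flip a b) (flip b a)
    where
    flip : ∀ a b → P ∣ a - b → P ∣ b - a
    flip a b P∣a-b = ≋⇒P∣- (≋-sym (mk≋ {a} {b} P∣a-b))

  0≤[p∣] : ∀ z → 0ℤ ≤ [p∣ z ]
  0≤[p∣] z with does (P ∣? z)
  ... | true = ℤ.+≤+ z≤n
  ... | false = ℤ.+≤+ z≤n

  [p∣]≤1 : ∀ z → [p∣ z ] ≤ 1ℤ
  [p∣]≤1 z with does (P ∣? z)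
  ... | true = ℤ.+≤+ (s≤s z≤n)
  ... | false = ℤ.+≤+ z≤n

  [p∣*]≤ : ∀ a b → [p∣ a * b ] ≤ [p∣ a ] + [p∣ b ]
  [p∣*]≤ a b = case (P ∣? a) (P ∣? b)
    where
    open ℤP.≤-Reasoning
    case : Dec (P ∣ a) → Dec (P ∣ b) → [p∣ a * b ] ≤ [p∣ a ] + [p∣ b ]
    case (yes P∣a) _ = begin
      [p∣ a * b ]         ≤⟨ [p∣]≤1 (a * b) ⟩
      1ℤ + 0ℤ             ≤⟨ ℤP.+-mono-≤ (ℤP.≤-reflexive (sym ([p∣]-yes P∣a))) (0≤[p∣] b) ⟩
      [p∣ a ] + [p∣ b ]   ∎
    case (no _) (yes P∣b) = begin
      [p∣ a * b ]         ≤⟨ [p∣]≤1 (a * b) ⟩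
      0ℤ + 1ℤ             ≤⟨ ℤP.+-mono-≤ (0≤[p∣] a) (ℤP.≤-reflexive (sym ([p∣]-yes P∣b))) ⟩
      [p∣ a ] + [p∣ b ]   ∎
    case (no P∤a) (no P∤b) = begin
      [p∣ a * b ]         ≡⟨ [p∣]-no (∤*∤ P∤a P∤b) ⟩
      0ℤ + 0ℤ             ≤⟨ ℤP.+-mono-≤ (0≤[p∣] a) (0≤[p∣] b) ⟩
      [p∣ a ] + [p∣ b ]   ∎

  [p∣*]≡ : ∀ a b → ¬ (P ∣ a × P ∣ b) → [p∣ a * b ] ≡ [p∣ a ] + [p∣ b ]
  [p∣*]≡ a b ¬both = case (P ∣? a) (P ∣? b)
    where
    case : Dec (P ∣ a) → Dec (P ∣ b) → [p∣ a * b ] ≡ [p∣ a ] + [p∣ b ]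
    case (yes P∣a) (yes P∣b) = ⊥-elim (¬both (P∣a , P∣b))
    case (yes P∣a) (no P∤b) =
      trans ([p∣]-yes (ℤD.∣m⇒∣m*n b P∣a)) (sym (cong₂ _+_ ([p∣]-yes P∣a) ([p∣]-no P∤b)))
    case (no P∤a) (yes P∣b) =
      trans ([p∣]-yes (ℤD.∣n⇒∣m*n a P∣b)) (sym (cong₂ _+_ ([p∣]-no P∤a) ([p∣]-yes P∣b)))
    case (no P∤a) (no P∤b) =
      trans ([p∣]-no (∤*∤ P∤a P∤b)) (sym (cong₂ _+_ ([p∣]-no P∤a) ([p∣]-no P∤b)))

  [p∣x-c]≡δ : ∀ {x} c → x ℕ.< p → [p∣ + x - c ] ≡ δ x (c %ℕ p)
  [p∣x-c]≡δ {x} c x<p with x ℕ.≟ c %ℕ p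
  ... | yes refl = [p∣]-yes (≋⇒P∣- (≋-sym (≋-%ℕ c)))
  ... | no x≢c = [p∣]-no λ P∣x-c → x≢c (trans (sym (%ℕ-<p x<p)) (≋⇒%ℕ≡ (mk≋ {+ x} {c} P∣x-c)))

  Σ[p∣x-c] : ∀ c → Σ p (λ x → [p∣ + x - c ]) ≡ 1ℤ
  Σ[p∣x-c] c = trans (Σ-cong p (λ x → [p∣x-c]≡δ c)) (Σ-δ p (%ℕ<p c))

  [p∣x*x] : ∀ x → [p∣ x * x ] ≡ [p∣ x ]
  [p∣x*x] x = [p∣]-⇔ (reduce ∘ P∣*⇒ {x} {x}) (ℤD.∣m⇒∣m*n x)

  #roots-divisible : ∀ {a} → P ∣ a → Σ p (λ x → [p∣ + x * + x - a ]) ≡ 1ℤ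
  #roots-divisible {a} P∣a = begin
    Σ p (λ x → [p∣ + x * + x - a ])   ≡⟨ Σ-cong p (λ x _ → root-is-0 (+ x)) ⟩
    Σ p (λ x → [p∣ + x - 0ℤ ])        ≡⟨ Σ[p∣x-c] 0ℤ ⟩
    1ℤ                                ∎
    where
    open ≡-Reasoning
    root-is-0 : ∀ x → [p∣ x * x - a ] ≡ [p∣ x - 0ℤ ]
    root-is-0 x = begin
      [p∣ x * x - a ]    ≡⟨ [p∣]-≋ (≋-+ (≋-refl {x * x}) (≋-neg (P∣⇒≋0 P∣a))) ⟩
      [p∣ x * x + 0ℤ ]   ≡⟨ cong [p∣_] (ℤP.+-identityʳ (x * x)) ⟩
      [p∣ x * x ]        ≡⟨ [p∣x*x] x ⟩
      [p∣ x ]            ≡⟨ cong [p∣_] (ℤP.+-identityʳ x) ⟨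
      [p∣ x - 0ℤ ]       ∎

  #roots-square : ∀ {a y} → ¬ P ∣ a → a ≋ y * y → Σ p (λ x → [p∣ + x * + x - a ]) ≡ + 2
  #roots-square {a} {y} P∤a a≋y² = begin
    Σ p (λ x → [p∣ + x * + x - a ])                         ≡⟨ Σ-cong p (λ x _ → two-roots (+ x)) ⟩
    Σ p (λ x → [p∣ + x - y ] + [p∣ + x - - y ])             ≡⟨ Σ-+ p (λ x → [p∣ + x - y ]) (λ x → [p∣ + x - - y ]) ⟩
    Σ p (λ x → [p∣ + x - y ]) + Σ p (λ x → [p∣ + x - - y ]) ≡⟨ cong₂ _+_ (Σ[p∣x-c] y) (Σ[p∣x-c] (- y)) ⟩
    + 2                                                     ∎
    where
    open ≡-Reasoning
    P∤y : ¬ P ∣ y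
    P∤y = P∤-square-root P∤a a≋y²
    two-roots : ∀ x → [p∣ x * x - a ] ≡ [p∣ x - y ] + [p∣ x - - y ]
    two-roots x = begin
      [p∣ x * x - a ]                ≡⟨ [p∣]-≋ (≋-+ (≋-refl {x * x}) (≋-neg a≋y²)) ⟩
      [p∣ x * x - y * y ]            ≡⟨ cong [p∣_] (difference-of-squares x y) ⟩
      [p∣ (x - y) * (x - - y) ]      ≡⟨ [p∣*]≡ (x - y) (x - - y) roots-distinct ⟩
      [p∣ x - y ] + [p∣ x - - y ]    ∎
      where
      difference-of-squares : ∀ x y → x * x - y * y ≡ (x - y) * (x - - y)
      difference-of-squares = solve-∀
      roots-distinct : ¬ (P ∣ x - y × P ∣ x - - y)
      roots-distinct (P∣x-y , P∣x+y) =
        [ P∤2 , P∤y ] (P∣*⇒ {+ 2} {y} (P∣-resp (ℤD.∣m∣n⇒∣m-n P∣x+y P∣x-y) (solve (x ∷ y ∷ []))))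

  #roots-nonsquare : ∀ {a} → ¬ IsSquare a → Σ p (λ x → [p∣ + x * + x - a ]) ≡ 0ℤ
  #roots-nonsquare {a} ¬a□ =
    trans (Σ-cong p (λ x _ → [p∣]-no (λ P∣x²-a → ¬a□ (+ x , ≋-sym (mk≋ P∣x²-a))))) (Σ-zero p)

  #square-roots : ∀ a → Σ p (λ x → [p∣ + x * + x - a ]) ≡ χ a + 1ℤ
  #square-roots a = count (residuosity a)
    where
    count : Residuosity a → Σ p (λ x → [p∣ + x * + x - a ]) ≡ χ a + 1ℤ
    count (divisible P∣a) = trans (#roots-divisible P∣a) (cong (_+ 1ℤ) (sym (χ-divisible P∣a)))
    count (residue P∤a (y , a≋y²)) = trans (#roots-square {y = y} P∤a a≋y²) (cong (_+ 1ℤ) (sym (χ-residue P∤a (y , a≋y²))))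
    count (nonresidue P∤a ¬a□) = trans (#roots-nonsquare ¬a□) (cong (_+ 1ℤ) (sym (χ-nonresidue P∤a ¬a□)))

  Σχ≡0 : Σ p (χ ∘ +_) ≡ 0ℤ
  Σχ≡0 = begin
    Σ p (χ ∘ +_)                                                ≡⟨ Σ-cong p (λ a _ → χ≡#roots-1 (+ a)) ⟩
    Σ p (λ a → #roots a - 1ℤ)                                   ≡⟨ Σ-difference p #roots (λ _ → 1ℤ) ⟩
    Σ p #roots - Σ p (λ _ → 1ℤ)                                 ≡⟨ cong (_- Σ p (λ _ → 1ℤ)) (Σ-swap p p (λ a x → [p∣ + x * + x - + a ])) ⟩
    Σ p (λ x → Σ p (λ a → [p∣ + x * + x - + a ])) - Σ p (λ _ → 1ℤ) ≡⟨ cong (_- Σ p (λ _ → 1ℤ)) (Σ-cong p (λ x _ → one-root-each x)) ⟩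
    Σ p (λ _ → 1ℤ) - Σ p (λ _ → 1ℤ)                             ≡⟨ ℤP.+-inverseʳ (Σ p (λ _ → 1ℤ)) ⟩
    0ℤ                                                          ∎
    where
    open ≡-Reasoning
    #roots : ℕ → ℤ
    #roots a = Σ p (λ x → [p∣ + x * + x - + a ])
    χ≡#roots-1 : ∀ a → χ a ≡ Σ p (λ x → [p∣ + x * + x - a ]) - 1ℤ
    χ≡#roots-1 a = begin
      χ a                 ≡⟨ +1-1 (χ a) ⟩
      χ a + 1ℤ - 1ℤ       ≡⟨ cong (_- 1ℤ) (#square-roots a) ⟨
      Σ p (λ x → [p∣ + x * + x - a ]) - 1ℤ ∎
      where
      +1-1 : ∀ c → c ≡ c + 1ℤ - 1ℤ
      +1-1 = solve-∀
    one-root-each : ∀ x → Σ p (λ a → [p∣ + x * + x - + a ]) ≡ 1ℤ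
    one-root-each x = trans (Σ-cong p (λ a _ → [p∣-]-comm (+ x * + x) (+ a))) (Σ[p∣x-c] (+ x * + x))

  Periodic : (ℤ → ℤ) → Set
  Periodic F = ∀ {a b} → a ≋ b → F a ≡ F b

  Σ-affine : ∀ (F : ℤ → ℤ) → Periodic F → ∀ c {d} → ¬ P ∣ d → Σ p (λ u → F (c + d * + u)) ≡ Σ p (F ∘ +_)
  Σ-affine F F-periodic c {d} P∤d =
    trans (Σ-cong p (λ u _ → F-periodic (≋-%ℕ (c + d * + u))))
          (Σ-bijection p (F ∘ +_) σ τ (λ u _ → %ℕ<p (c + d * + u)) (λ w _ → %ℕ<p ((+ w - c) * d ⁻¹)) τσ≡id στ≡id)
    where
    σ τ : ℕ → ℕ
    σ u = (c + d * + u) %ℕ p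
    τ w = ((+ w - c) * d ⁻¹) %ℕ p
    dd⁻¹≋1 : d * d ⁻¹ ≋ 1ℤ
    dd⁻¹≋1 = *-inverseʳ d P∤d
    τσ≡id : ∀ u → u ℕ.< p → τ (σ u) ≡ u
    τσ≡id u u<p = ≋-<p⇒≡ (%ℕ<p ((+ σ u - c) * d ⁻¹)) u<p (begin
      + τ (σ u)                         ≈⟨ ≋-%ℕ ((+ σ u - c) * d ⁻¹) ⟨
      (+ σ u - c) * d ⁻¹                ≈⟨ ≋-* (≋-+ (≋-%ℕ (c + d * + u)) (≋-refl { - c})) ≋-refl ⟨
      (c + d * + u - c) * d ⁻¹          ≡⟨ regroup c d (+ u) (d ⁻¹) ⟩
      + u * (d * d ⁻¹)                  ≈⟨ ≋-* (≋-refl {+ u}) dd⁻¹≋1 ⟩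
      + u * 1ℤ                          ≡⟨ ℤP.*-identityʳ (+ u) ⟩
      + u                               ∎)
      where
      open ≋-Reasoning
      regroup : ∀ c d u i → (c + d * u - c) * i ≡ u * (d * i)
      regroup = solve-∀
    στ≡id : ∀ w → w ℕ.< p → σ (τ w) ≡ w
    στ≡id w w<p = ≋-<p⇒≡ (%ℕ<p (c + d * + τ w)) w<p (begin
      + σ (τ w)                         ≈⟨ ≋-%ℕ (c + d * + τ w) ⟨
      c + d * + τ w                     ≈⟨ ≋-+ (≋-refl {c}) (≋-* (≋-refl {d}) (≋-%ℕ ((+ w - c) * d ⁻¹))) ⟨
      c + d * ((+ w - c) * d ⁻¹)        ≡⟨ regroup c d (+ w) (d ⁻¹) ⟩
      c + (+ w - c) * (d * d ⁻¹)        ≈⟨ ≋-+ (≋-refl {c}) (≋-* (≋-refl {+ w - c}) dd⁻¹≋1) ⟩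
      c + (+ w - c) * 1ℤ                ≡⟨ cancel c (+ w) ⟩
      + w                               ∎)
      where
      open ≋-Reasoning
      regroup : ∀ c d w i → c + d * ((w - c) * i) ≡ c + (w - c) * (d * i)
      regroup = solve-∀
      cancel : ∀ c w → c + (w - c) * 1ℤ ≡ w
      cancel = solve-∀

  Σ[p∣affine] : ∀ c {d} → ¬ P ∣ d → Σ p (λ y → [p∣ c + d * + y ]) ≡ 1ℤ
  Σ[p∣affine] c {d} P∤d = begin
    Σ p (λ y → [p∣ c + d * + y ])   ≡⟨ Σ-affine [p∣_] [p∣]-≋ c P∤d ⟩
    Σ p (λ y → [p∣ + y ])           ≡⟨ Σ-cong p (λ y _ → cong [p∣_] (ℤP.+-identityʳ (+ y))) ⟨
    Σ p (λ y → [p∣ + y - 0ℤ ])      ≡⟨ Σ[p∣x-c] 0ℤ ⟩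
    1ℤ                              ∎
    where open ≡-Reasoning

  χ≤1 : ∀ a → χ a ≤ 1ℤ
  χ≤1 a = bound (residuosity a)
    where
    bound : Residuosity a → χ a ≤ 1ℤ
    bound (divisible P∣a) = ℤP.≤-trans (ℤP.≤-reflexive (χ-divisible P∣a)) (ℤ.+≤+ z≤n)
    bound (residue P∤a a□) = ℤP.≤-reflexive (χ-residue P∤a a□)
    bound (nonresidue P∤a ¬a□) = ℤP.≤-trans (ℤP.≤-reflexive (χ-nonresidue P∤a ¬a□)) ℤ.-≤+

  -1≤χ : ∀ a → -1ℤ ≤ χ a
  -1≤χ a = bound (residuosity a)
    where
    bound : Residuosity a → -1ℤ ≤ χ a
    bound (divisible P∣a) = ℤP.≤-trans ℤ.-≤+ (ℤP.≤-reflexive (sym (χ-divisible P∣a)))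
    bound (residue P∤a a□) = ℤP.≤-trans ℤ.-≤+ (ℤP.≤-reflexive (sym (χ-residue P∤a a□)))
    bound (nonresidue P∤a ¬a□) = ℤP.≤-reflexive (sym (χ-nonresidue P∤a ¬a□))

  χ≡1⇒square : ∀ {a} → χ a ≡ 1ℤ → IsSquare a
  χ≡1⇒square {a} χa≡1 = square (residuosity a)
    where
    square : Residuosity a → IsSquare a
    square (divisible P∣a) = contradiction (trans (sym (χ-divisible P∣a)) χa≡1) (λ ())
    square (residue _ a□) = a□
    square (nonresidue P∤a ¬a□) = contradiction (trans (sym (χ-nonresidue P∤a ¬a□)) χa≡1) (λ ())

  Σχ-affine : ∀ c d → Σ p (λ u → χ (c + d * + u)) ≡ + p * ([p∣ d ] * χ c)
  Σχ-affine c d = case (P ∣? d)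
    where
    open ≡-Reasoning
    case : Dec (P ∣ d) → Σ p (λ u → χ (c + d * + u)) ≡ + p * ([p∣ d ] * χ c)
    case (no P∤d) = begin
      Σ p (λ u → χ (c + d * + u))   ≡⟨ Σ-affine χ χ-≋ c P∤d ⟩
      Σ p (χ ∘ +_)                  ≡⟨ Σχ≡0 ⟩
      0ℤ                            ≡⟨ ℤP.*-zeroʳ (+ p) ⟨
      + p * (0ℤ * χ c)              ≡⟨ cong (λ i → + p * (i * χ c)) ([p∣]-no P∤d) ⟨
      + p * ([p∣ d ] * χ c)         ∎
    case (yes P∣d) = begin
      Σ p (λ u → χ (c + d * + u))   ≡⟨ Σ-cong p (λ u _ → χ-≋ (c+du≋c u)) ⟩
      Σ p (λ _ → χ c)               ≡⟨ Σ-const p (χ c) ⟩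
      + p * χ c                     ≡⟨ cong (+ p *_) (ℤP.*-identityˡ (χ c)) ⟨
      + p * (1ℤ * χ c)              ≡⟨ cong (λ i → + p * (i * χ c)) ([p∣]-yes P∣d) ⟨
      + p * ([p∣ d ] * χ c)         ∎
      where
      c+du≋c : ∀ u → c + d * + u ≋ c
      c+du≋c u = ≋-trans (≋-+ (≋-refl {c}) (P∣⇒≋0 (ℤD.∣m⇒∣m*n (+ u) P∣d))) (≡⇒≋ (ℤP.+-identityʳ c))

  χ-square : ∀ {y} → ¬ P ∣ y → χ (y * y) ≡ 1ℤ
  χ-square {y} P∤y = χ-residue (∤*∤ P∤y P∤y) (y , ≋-refl)

  square*square : ∀ {a b} → IsSquare a → IsSquare b → IsSquare (a * b)
  square*square {a} {b} (x , a≋x²) (y , b≋y²) = x * y , ≋-trans (≋-* a≋x² b≋y²) (≡⇒≋ (solve (x ∷ y ∷ [])))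

  square*nonsquare : ∀ {a b} → ¬ P ∣ a → IsSquare a → ¬ IsSquare b → ¬ IsSquare (a * b)
  square*nonsquare {a} {b} P∤a (x , a≋x²) ¬b□ (z , ab≋z²) = ¬b□ (x ⁻¹ * z , (begin
    b                               ≡⟨ solve (b ∷ []) ⟩
    1ℤ * 1ℤ * b                     ≈⟨ ≋-* (≋-* xx⁻¹≋1 xx⁻¹≋1) (≋-refl {b}) ⟨
    x * x ⁻¹ * (x * x ⁻¹) * b       ≡⟨ regroup₁ x (x ⁻¹) b ⟩
    x ⁻¹ * x ⁻¹ * (x * x * b)       ≈⟨ ≋-* (≋-refl {x ⁻¹ * x ⁻¹}) (≋-* a≋x² (≋-refl {b})) ⟨
    x ⁻¹ * x ⁻¹ * (a * b)           ≈⟨ ≋-* (≋-refl {x ⁻¹ * x ⁻¹}) ab≋z² ⟩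
    x ⁻¹ * x ⁻¹ * (z * z)           ≡⟨ regroup₂ (x ⁻¹) z ⟩
    x ⁻¹ * z * (x ⁻¹ * z)           ∎))
    where
    open ≋-Reasoning
    xx⁻¹≋1 : x * x ⁻¹ ≋ 1ℤ
    xx⁻¹≋1 = *-inverseʳ x (P∤-square-root P∤a a≋x²)
    regroup₁ : ∀ x i b → x * i * (x * i) * b ≡ i * i * (x * x * b)
    regroup₁ = solve-∀
    regroup₂ : ∀ i z → i * i * (z * z) ≡ i * z * (i * z)
    regroup₂ = solve-∀

  nonsquare*nonsquare : ∀ {a b} → ¬ P ∣ a → ¬ IsSquare a → ¬ P ∣ b → ¬ IsSquare b → IsSquare (a * b)
  nonsquare*nonsquare {a} {b} P∤a ¬a□ P∤b ¬b□ = χ≡1⇒square (begin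
    χ (a * b)                        ≡⟨ χ-≋ (≋-* (≋-refl {a}) (≋-%ℕ b)) ⟩
    χ (a * + r)                      ≡⟨ +c-c (χ (a * + r)) (χ (+ r)) ⟩
    (χ (a * + r) + χ (+ r)) - χ (+ r) ≡⟨ cong₂ _-_ (Σ-nonpos≡0 p u≤0 Σu≡0 r (%ℕ<p b)) χr≡-1 ⟩
    0ℤ - -1ℤ                         ≡⟨⟩
    1ℤ                               ∎)
    where
    open ≡-Reasoning
    r : ℕ
    r = b %ℕ p
    +c-c : ∀ x c → x ≡ (x + c) - c
    +c-c = solve-∀
    χr≡-1 : χ (+ r) ≡ -1ℤ
    χr≡-1 = trans (χ-≋ (≋-sym (≋-%ℕ b))) (χ-nonresidue P∤b ¬b□)
    -- every u v ≤ 0 while Σ u = 0, so u vanishes termwise; at v = b this reads χ (a b) = - χ b = 1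
    u : ℕ → ℤ
    u v = χ (a * + v) + χ (+ v)
    u≤0 : ∀ v → v ℕ.< p → u v ≤ 0ℤ
    u≤0 v _ = u≤0′ (residuosity (+ v))
      where
      u≤0′ : Residuosity (+ v) → u v ≤ 0ℤ
      u≤0′ (divisible P∣v) = ℤP.≤-reflexive (cong₂ _+_ (χ-divisible (ℤD.∣n⇒∣m*n a P∣v)) (χ-divisible P∣v))
      u≤0′ (residue P∤v v□) = ℤP.≤-reflexive (cong₂ _+_ (χ-nonresidue (∤*∤ P∤a P∤v) av-nonsquare) (χ-residue P∤v v□))
        where
        av-nonsquare : ¬ IsSquare (a * + v)
        av-nonsquare av□ = square*nonsquare P∤v v□ ¬a□ (IsSquare-≋ (≡⇒≋ (ℤP.*-comm a (+ v))) av□)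
      u≤0′ (nonresidue P∤v ¬v□) =
        ℤP.≤-trans (ℤP.+-mono-≤ (χ≤1 (a * + v)) (ℤP.≤-reflexive (χ-nonresidue P∤v ¬v□))) ℤP.≤-refl
    Σu≡0 : Σ p u ≡ 0ℤ
    Σu≡0 = begin
      Σ p u                                     ≡⟨ Σ-+ p (λ v → χ (a * + v)) (χ ∘ +_) ⟩
      Σ p (λ v → χ (a * + v)) + Σ p (χ ∘ +_)    ≡⟨ cong₂ _+_ (trans (Σ-cong p (λ v _ → cong χ (sym (ℤP.+-identityˡ (a * + v))))) (Σ-affine χ χ-≋ 0ℤ P∤a)) Σχ≡0 ⟩
      Σ p (χ ∘ +_) + 0ℤ                         ≡⟨ cong (_+ 0ℤ) Σχ≡0 ⟩
      0ℤ                                        ∎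

  χ-* : ∀ a b → χ (a * b) ≡ χ a * χ b
  χ-* a b = multiplicative (residuosity a) (residuosity b)
    where
    multiplicative : Residuosity a → Residuosity b → χ (a * b) ≡ χ a * χ b
    multiplicative (divisible P∣a) _ = begin
      χ (a * b)      ≡⟨ χ-divisible (ℤD.∣m⇒∣m*n b P∣a) ⟩
      0ℤ             ≡⟨ cong (_* χ b) (χ-divisible P∣a) ⟨
      χ a * χ b      ∎
      where open ≡-Reasoning
    multiplicative _ (divisible P∣b) = begin
      χ (a * b)      ≡⟨ χ-divisible (ℤD.∣n⇒∣m*n a P∣b) ⟩
      0ℤ             ≡⟨ ℤP.*-zeroʳ (χ a) ⟨
      χ a * 0ℤ       ≡⟨ cong (χ a *_) (χ-divisible P∣b) ⟨
      χ a * χ b      ∎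
      where open ≡-Reasoning
    multiplicative (residue P∤a a□) (residue P∤b b□) =
      trans (χ-residue (∤*∤ P∤a P∤b) (square*square a□ b□)) (sym (cong₂ _*_ (χ-residue P∤a a□) (χ-residue P∤b b□)))
    multiplicative (residue P∤a a□) (nonresidue P∤b ¬b□) =
      trans (χ-nonresidue (∤*∤ P∤a P∤b) (square*nonsquare P∤a a□ ¬b□))
            (sym (cong₂ _*_ (χ-residue P∤a a□) (χ-nonresidue P∤b ¬b□)))
    multiplicative (nonresidue P∤a ¬a□) (residue P∤b b□) =
      trans (χ-nonresidue (∤*∤ P∤a P∤b) (square*nonsquare P∤b b□ ¬a□ ∘ IsSquare-≋ (≡⇒≋ (ℤP.*-comm a b))))
            (sym (cong₂ _*_ (χ-nonresidue P∤a ¬a□) (χ-residue P∤b b□)))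
    multiplicative (nonresidue P∤a ¬a□) (nonresidue P∤b ¬b□) =
      trans (χ-residue (∤*∤ P∤a P∤b) (nonsquare*nonsquare P∤a ¬a□ P∤b ¬b□))
            (sym (cong₂ _*_ (χ-nonresidue P∤a ¬a□) (χ-nonresidue P∤b ¬b□)))

  χ1≡1 : χ 1ℤ ≡ 1ℤ
  χ1≡1 = χ-square P∤1

  χ²≡1-δ : ∀ {w} → w ℕ.< p → χ (+ w) * χ (+ w) ≡ 1ℤ - δ w 0
  χ²≡1-δ {zero} _ = cong₂ _*_ (χ-divisible P∣0) (χ-divisible P∣0)
  χ²≡1-δ {suc w} w<p = trans (sym (χ-* (+ suc w) (+ suc w))) (χ-square (P∤<p (s≤s z≤n) w<p))

  w[e+w]≋w²[1+e/w] : ∀ {w} e → ¬ P ∣ w → w * (e + w) ≋ w * w * (1ℤ + e * w ⁻¹)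
  w[e+w]≋w²[1+e/w] {w} e P∤w = begin
    w * (e + w)                      ≡⟨ regroup₂ w e ⟨
    w * w + e * w * 1ℤ               ≈⟨ ≋-+ (≋-refl {w * w}) (≋-* (≋-refl {e * w}) (*-inverseʳ w P∤w)) ⟨
    w * w + e * w * (w * w ⁻¹)       ≡⟨ regroup₁ w e (w ⁻¹) ⟨
    w * w * (1ℤ + e * w ⁻¹)          ∎
    where
    open ≋-Reasoning
    regroup₁ : ∀ w e i → w * w * (1ℤ + e * i) ≡ w * w + e * w * (w * i)
    regroup₁ = solve-∀
    regroup₂ : ∀ w e → w * w + e * w * 1ℤ ≡ w * (e + w)
    regroup₂ = solve-∀

  residue⁻¹ : ℕ → ℕ
  residue⁻¹ w = (+ w) ⁻¹ %ℕ p

  residue⁻¹<p : ∀ w → residue⁻¹ w ℕ.< p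
  residue⁻¹<p w = %ℕ<p ((+ w) ⁻¹)

  residue⁻¹-0 : residue⁻¹ 0 ≡ 0
  residue⁻¹-0 = trans (cong (_%ℕ p) (⁻¹-P∣ P∣0)) (%ℕ-<p 0<p)

  residue⁻¹-involutive : ∀ w → w ℕ.< p → residue⁻¹ (residue⁻¹ w) ≡ w
  residue⁻¹-involutive zero _ = trans (cong residue⁻¹ residue⁻¹-0) residue⁻¹-0
  residue⁻¹-involutive (suc w) w<p = trans (≋⇒%ℕ≡ (⁻¹-unique w⁻¹*w≋1)) (%ℕ-<p w<p)
    where
    w⁻¹*w≋1 : + residue⁻¹ (suc w) * + suc w ≋ 1ℤ
    w⁻¹*w≋1 = ≋-trans (≋-* (≋-sym (≋-%ℕ ((+ suc w) ⁻¹))) (≋-refl {+ suc w}))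
                (≋-trans (≡⇒≋ (ℤP.*-comm ((+ suc w) ⁻¹) (+ suc w))) (*-inverseʳ (+ suc w) (P∤<p (s≤s z≤n) w<p)))

  Jacobi-sum-divisible : ∀ e → P ∣ e → Σ p (λ w → χ (+ w) * χ (e + + w)) ≡ + p - 1ℤ
  Jacobi-sum-divisible e P∣e = begin
    Σ p (λ w → χ (+ w) * χ (e + + w))   ≡⟨ Σ-cong p (λ w w<p → trans (cong (χ (+ w) *_) (χ-≋ (e+w≋w w))) (χ²≡1-δ w<p)) ⟩
    Σ p (λ w → 1ℤ - δ w 0)              ≡⟨ Σ-difference p (λ _ → 1ℤ) (λ w → δ w 0) ⟩
    Σ p (λ _ → 1ℤ) - Σ p (λ w → δ w 0)  ≡⟨ cong₂ _-_ (trans (Σ-const p 1ℤ) (ℤP.*-identityʳ (+ p))) (Σ-δ p 0<p) ⟩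
    + p - 1ℤ                            ∎
    where
    open ≡-Reasoning
    e+w≋w : ∀ w → e + + w ≋ + w
    e+w≋w w = ≋-trans (≋-+ (P∣⇒≋0 P∣e) (≋-refl {+ w})) (≡⇒≋ (ℤP.+-identityˡ (+ w)))

  Jacobi-sum-indivisible : ∀ e → ¬ P ∣ e → Σ p (λ w → χ (+ w) * χ (e + + w)) ≡ -1ℤ
  Jacobi-sum-indivisible e P∤e = begin
    Σ p (λ w → χ (+ w) * χ (e + + w))            ≡⟨ Σ-cong p χχ≡H[w⁻¹]-δ ⟩
    Σ p (λ w → H (residue⁻¹ w) - δ w 0)          ≡⟨ Σ-difference p (H ∘ residue⁻¹) (λ w → δ w 0) ⟩
    Σ p (H ∘ residue⁻¹) - Σ p (λ w → δ w 0)      ≡⟨ cong₂ _-_ (Σ-bijection p H residue⁻¹ residue⁻¹ (λ w _ → residue⁻¹<p w) (λ w _ → residue⁻¹<p w)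
                                                                             residue⁻¹-involutive residue⁻¹-involutive)
                                                              (Σ-δ p 0<p) ⟩
    Σ p H - 1ℤ                                   ≡⟨ cong (_- 1ℤ) (Σχ-affine 1ℤ e) ⟩
    + p * ([p∣ e ] * χ 1ℤ) - 1ℤ                  ≡⟨ cong (λ z → + p * (z * χ 1ℤ) - 1ℤ) ([p∣]-no P∤e) ⟩
    + p * 0ℤ - 1ℤ                                ≡⟨ cong (_- 1ℤ) (ℤP.*-zeroʳ (+ p)) ⟩
    -1ℤ                                          ∎
    where
    open ≡-Reasoning
    -- the substitution w ↦ w⁻¹ turns χ(w) χ(e + w) = χ(w²) χ(1 + e w⁻¹) into a linear character sum
    H : ℕ → ℤ
    H v = χ (1ℤ + e * + v)
    χχ≡H[w⁻¹]-δ : ∀ w → w ℕ.< p → χ (+ w) * χ (e + + w) ≡ H (residue⁻¹ w) - δ w 0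
    χχ≡H[w⁻¹]-δ zero _ = begin
      χ 0ℤ * χ (e + 0ℤ)        ≡⟨ cong (_* χ (e + 0ℤ)) (χ-divisible P∣0) ⟩
      0ℤ                       ≡⟨ cong (_- 1ℤ) χ1≡1 ⟨
      χ 1ℤ - 1ℤ                ≡⟨ cong (λ z → χ z - 1ℤ) (trans (cong (λ v → 1ℤ + e * + v) residue⁻¹-0) (cong (_+_ 1ℤ) (ℤP.*-zeroʳ e))) ⟨
      H (residue⁻¹ 0) - δ 0 0  ∎
    χχ≡H[w⁻¹]-δ (suc w) w<p = begin
      χ W * χ (e + W)                   ≡⟨ χ-* W (e + W) ⟨
      χ (W * (e + W))                   ≡⟨ χ-≋ (≋-trans (w[e+w]≋w²[1+e/w] e P∤W) (≋-* (≋-refl {W * W}) (≋-+ (≋-refl {1ℤ}) (≋-* (≋-refl {e}) (≋-%ℕ (W ⁻¹)))))) ⟩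
      χ (W * W * (1ℤ + e * V))          ≡⟨ χ-* (W * W) (1ℤ + e * V) ⟩
      χ (W * W) * H V′                  ≡⟨ cong (_* H V′) (χ-square P∤W) ⟩
      1ℤ * H V′                         ≡⟨ ℤP.*-identityˡ (H V′) ⟩
      H V′                              ≡⟨ ℤP.+-identityʳ (H V′) ⟨
      H V′ - 0ℤ                         ≡⟨ cong (_-_ (H V′)) (δ-≢ {suc w} {0} (λ ())) ⟨
      H (residue⁻¹ (suc w)) - δ (suc w) 0 ∎
      where
      V′ : ℕ
      V′ = residue⁻¹ (suc w)
      W V : ℤ
      W = + suc w
      V = + V′
      P∤W : ¬ P ∣ W
      P∤W = P∤<p (s≤s z≤n) w<p

  Jacobi-sum : ∀ e → Σ p (λ w → χ (+ w) * χ (e + + w)) ≡ -1ℤ + + p * [p∣ e ]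
  Jacobi-sum e = case (P ∣? e)
    where
    open ≡-Reasoning
    case : Dec (P ∣ e) → Σ p (λ w → χ (+ w) * χ (e + + w)) ≡ -1ℤ + + p * [p∣ e ]
    case (yes P∣e) = begin
      Σ p (λ w → χ (+ w) * χ (e + + w))   ≡⟨ Jacobi-sum-divisible e P∣e ⟩
      + p - 1ℤ                            ≡⟨ regroup (+ p) ⟩
      -1ℤ + + p * 1ℤ                      ≡⟨ cong (λ i → -1ℤ + + p * i) ([p∣]-yes P∣e) ⟨
      -1ℤ + + p * [p∣ e ]                 ∎
      where
      regroup : ∀ q → q - 1ℤ ≡ -1ℤ + q * 1ℤ
      regroup = solve-∀
    case (no P∤e) = begin
      Σ p (λ w → χ (+ w) * χ (e + + w))   ≡⟨ Jacobi-sum-indivisible e P∤e ⟩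
      -1ℤ                                 ≡⟨ ℤP.+-identityʳ -1ℤ ⟨
      -1ℤ + 0ℤ                            ≡⟨ cong (_+_ -1ℤ) (ℤP.*-zeroʳ (+ p)) ⟨
      -1ℤ + + p * 0ℤ                      ≡⟨ cong (λ i → -1ℤ + + p * i) ([p∣]-no P∤e) ⟨
      -1ℤ + + p * [p∣ e ]                 ∎

  a+bt≋b[a/b+t] : ∀ a {b} t → ¬ P ∣ b → a + b * t ≋ b * (a * b ⁻¹ + t)
  a+bt≋b[a/b+t] a {b} t P∤b = ≋-sym (begin
    b * (a * b ⁻¹ + t)           ≡⟨ regroup a b (b ⁻¹) t ⟩
    a * (b * b ⁻¹) + b * t       ≈⟨ ≋-+ (≋-* (≋-refl {a}) (*-inverseʳ b P∤b)) (≋-refl {b * t}) ⟩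
    a * 1ℤ + b * t               ≡⟨ cong (_+ b * t) (ℤP.*-identityʳ a) ⟩
    a + b * t                    ∎)
    where
    open ≋-Reasoning
    regroup : ∀ a b i t → b * (a * i + t) ≡ a * (b * i) + b * t
    regroup = solve-∀

  bd[c/d-a/b]≋bc-ad : ∀ a {b} c {d} → ¬ P ∣ b → ¬ P ∣ d → b * d * (c * d ⁻¹ - a * b ⁻¹) ≋ b * c - a * d
  bd[c/d-a/b]≋bc-ad a {b} c {d} P∤b P∤d = begin
    b * d * (c * d ⁻¹ - a * b ⁻¹)              ≡⟨ regroup a b c d (b ⁻¹) (d ⁻¹) ⟩
    b * c * (d * d ⁻¹) - a * d * (b * b ⁻¹)    ≈⟨ ≋-+ (≋-* (≋-refl {b * c}) (*-inverseʳ d P∤d)) (≋-neg (≋-* (≋-refl {a * d}) (*-inverseʳ b P∤b))) ⟩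
    b * c * 1ℤ - a * d * 1ℤ                    ≡⟨ cong₂ _-_ (ℤP.*-identityʳ (b * c)) (ℤP.*-identityʳ (a * d)) ⟩
    b * c - a * d                              ∎
    where
    open ≋-Reasoning
    regroup : ∀ a b c d b' d' → b * d * (c * d' - a * b') ≡ b * c * (d * d') - a * d * (b * b')
    regroup = solve-∀

  Σχχ-affine : ∀ a b c d → ¬ P ∣ b → ¬ P ∣ d →
               Σ p (λ t → χ (a + b * + t) * χ (c + d * + t)) ≡ χ b * χ d * (-1ℤ + + p * [p∣ b * c - a * d ])
  Σχχ-affine a b c d P∤b P∤d = begin
    Σ p (λ t → χ (a + b * + t) * χ (c + d * + t))   ≡⟨ Σ-cong p (λ t _ → factor-out (+ t)) ⟩
    Σ p (λ t → χ b * χ d * F (α + 1ℤ * + t))        ≡⟨ Σ-*ˡ p (χ b * χ d) (λ t → F (α + 1ℤ * + t)) ⟩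
    χ b * χ d * Σ p (λ t → F (α + 1ℤ * + t))        ≡⟨ cong (χ b * χ d *_) (Σ-affine F F-periodic α P∤1) ⟩
    χ b * χ d * Σ p (F ∘ +_)                        ≡⟨ cong (χ b * χ d *_) (Jacobi-sum (γ - α)) ⟩
    χ b * χ d * (-1ℤ + + p * [p∣ γ - α ])           ≡⟨ cong (λ z → χ b * χ d * (-1ℤ + + p * z)) ([p∣]-⇔ to from) ⟩
    χ b * χ d * (-1ℤ + + p * [p∣ b * c - a * d ])   ∎
    where
    open ≡-Reasoning
    α γ : ℤ
    α = a * b ⁻¹
    γ = c * d ⁻¹
    F : ℤ → ℤ
    F w = χ w * χ (γ - α + w)
    F-periodic : Periodic F
    F-periodic x≋y = cong₂ _*_ (χ-≋ x≋y) (χ-≋ (≋-+ (≋-refl {γ - α}) x≋y))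
    regroup : ∀ x y u v → x * u * (y * v) ≡ x * y * (u * v)
    regroup = solve-∀
    shift : ∀ α γ t → γ + t ≡ γ - α + (α + 1ℤ * t)
    shift = solve-∀
    factor-out : ∀ t → χ (a + b * t) * χ (c + d * t) ≡ χ b * χ d * F (α + 1ℤ * t)
    factor-out t = begin
      χ (a + b * t) * χ (c + d * t)             ≡⟨ cong₂ _*_ (trans (χ-≋ (a+bt≋b[a/b+t] a t P∤b)) (χ-* b (α + t)))
                                                             (trans (χ-≋ (a+bt≋b[a/b+t] c t P∤d)) (χ-* d (γ + t))) ⟩
      χ b * χ (α + t) * (χ d * χ (γ + t))       ≡⟨ regroup (χ b) (χ d) (χ (α + t)) (χ (γ + t)) ⟩
      χ b * χ d * (χ (α + t) * χ (γ + t))       ≡⟨ cong (λ z → χ b * χ d * (χ (α + z) * χ (γ + t))) (ℤP.*-identityˡ t) ⟨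
      χ b * χ d * (χ (α + 1ℤ * t) * χ (γ + t))  ≡⟨ cong (λ z → χ b * χ d * (χ (α + 1ℤ * t) * χ z)) (shift α γ t) ⟩
      χ b * χ d * F (α + 1ℤ * t)                ∎
    to : P ∣ γ - α → P ∣ b * c - a * d
    to P∣γ-α = P∣-resp-≋ (ℤD.∣n⇒∣m*n (b * d) P∣γ-α) (bd[c/d-a/b]≋bc-ad a c P∤b P∤d)
    from : P ∣ b * c - a * d → P ∣ γ - α
    from P∣bc-ad = [ ⊥-elim ∘ ∤*∤ P∤b P∤d , id ]′
                     (P∣*⇒ {b * d} {γ - α} (P∣-resp-≋ P∣bc-ad (≋-sym (bd[c/d-a/b]≋bc-ad a c P∤b P∤d))))

  P∤4 : ¬ P ∣ + 4
  P∤4 P∣4 = [ P∤2 , P∤2 ] (P∣*⇒ {+ 2} {+ 2} P∣4)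

  #roots-quadratic : ∀ b c → Σ p (λ x → [p∣ + x * + x + b * + x + c ]) ≡ χ (b * b - + 4 * c) + 1ℤ
  #roots-quadratic b c = begin
    Σ p (λ x → [p∣ + x * + x + b * + x + c ])       ≡⟨ Σ-cong p (λ x _ → complete-square (+ x)) ⟩
    Σ p (λ x → F (b + + 2 * + x))                   ≡⟨ Σ-affine F F-periodic b P∤2 ⟩
    Σ p (λ y → [p∣ + y * + y - Δ ])                 ≡⟨ #square-roots Δ ⟩
    χ Δ + 1ℤ                                        ∎
    where
    open ≡-Reasoning
    Δ : ℤ
    Δ = b * b - + 4 * c
    F : ℤ → ℤ
    F y = [p∣ y * y - Δ ]
    F-periodic : Periodic F
    F-periodic x≋y = [p∣]-≋ (≋-+ (≋-* x≋y x≋y) (≋-refl { - Δ}))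
    complete-square : ∀ x → [p∣ x * x + b * x + c ] ≡ F (b + + 2 * x)
    complete-square x = [p∣]-⇔
      (λ P∣f → P∣-resp (ℤD.∣n⇒∣m*n (+ 4) P∣f) (identity x b c))
      (λ P∣4f → [ ⊥-elim ∘ P∤4 , id ]′ (P∣*⇒ {+ 4} {x * x + b * x + c} (P∣-resp P∣4f (sym (identity x b c)))))
      where
      identity : ∀ x b c → + 4 * (x * x + b * x + c) ≡ (b + + 2 * x) * (b + + 2 * x) - (b * b - + 4 * c)
      identity = solve-∀

  #roots-quadratic≤2 : ∀ b c → Σ p (λ x → [p∣ + x * + x + b * + x + c ]) ≤ + 2
  #roots-quadratic≤2 b c = ℤP.≤-trans (ℤP.≤-reflexive (#roots-quadratic b c)) (ℤP.+-monoˡ-≤ 1ℤ (χ≤1 _))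

  root : ℤ → ℤ → ℤ
  root a b = - a * b ⁻¹

  root-spec : ∀ a {b} → ¬ P ∣ b → root a b * b ≋ - a
  root-spec a {b} P∤b = begin
    - a * b ⁻¹ * b       ≡⟨ regroup (- a) b (b ⁻¹) ⟩
    - a * (b * b ⁻¹)     ≈⟨ ≋-* (≋-refl { - a}) (*-inverseʳ b P∤b) ⟩
    - a * 1ℤ             ≡⟨ ℤP.*-identityʳ (- a) ⟩
    - a                  ∎
    where
    open ≋-Reasoning
    regroup : ∀ a b i → a * i * b ≡ a * (b * i)
    regroup = solve-∀

  [p∣affine]≡[p∣y-root] : ∀ a {b} y → ¬ P ∣ b → [p∣ a + b * y ] ≡ [p∣ y - root a b ]
  [p∣affine]≡[p∣y-root] a {b} y P∤b = begin
    [p∣ a + b * y ]               ≡⟨ [p∣]-≋ (a+bt≋b[a/b+t] a y P∤b) ⟩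
    [p∣ b * (a * b ⁻¹ + y) ]      ≡⟨ [p∣]-⇔ ([ ⊥-elim ∘ P∤b , id ]′ ∘ P∣*⇒ {b} {a * b ⁻¹ + y}) (ℤD.∣n⇒∣m*n b) ⟩
    [p∣ a * b ⁻¹ + y ]            ≡⟨ cong [p∣_] (regroup a (b ⁻¹) y) ⟩
    [p∣ y - root a b ]            ∎
    where
    open ≡-Reasoning
    regroup : ∀ a i y → a * i + y ≡ y - - a * i
    regroup = solve-∀

  Σ-pick-root : ∀ (G : ℤ → ℤ) → Periodic G → ∀ a {b} → ¬ P ∣ b → Σ p (λ y → G (+ y) * [p∣ a + b * + y ]) ≡ G (root a b)
  Σ-pick-root G G-periodic a {b} P∤b = begin
    Σ p (λ y → G (+ y) * [p∣ a + b * + y ])    ≡⟨ Σ-cong p (λ y y<p → cong (G (+ y) *_) (trans ([p∣affine]≡[p∣y-root] a (+ y) P∤b) ([p∣x-c]≡δ r y<p))) ⟩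
    Σ p (λ y → G (+ y) * δ y (r %ℕ p))         ≡⟨ Σ-*δ p (G ∘ +_) (%ℕ<p r) ⟩
    G (+ (r %ℕ p))                             ≡⟨ G-periodic (≋-%ℕ r) ⟨
    G r                                        ∎
    where
    open ≡-Reasoning
    r : ℤ
    r = root a b

  χ-drop-square : ∀ {z w u} → ¬ P ∣ w → z ≋ w * w * u → χ z ≡ χ u
  χ-drop-square {z} {w} {u} P∤w z≋w²u = begin
    χ z                 ≡⟨ χ-≋ z≋w²u ⟩
    χ (w * w * u)       ≡⟨ χ-* (w * w) u ⟩
    χ (w * w) * χ u     ≡⟨ cong (_* χ u) (χ-square P∤w) ⟩
    1ℤ * χ u            ≡⟨ ℤP.*-identityˡ (χ u) ⟩
    χ u                 ∎
    where open ≡-Reasoning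

  P∤-of-*≋ : ∀ {a b c} → a * b ≋ c → ¬ P ∣ c → ¬ P ∣ a
  P∤-of-*≋ {a} {b} ab≋c P∤c P∣a = P∤c (P∣-resp-≋ (ℤD.∣m⇒∣m*n b P∣a) ab≋c)

  -- The family y² = g x + t h x

  g h : ℤ → ℤ
  g x = x * x * x - + 3 * x + 1ℤ
  h x = x * x - x

  cubic≡g+h*t : ∀ t x → cubic t x ≡ g x + h x * t
  cubic≡g+h*t = expand
    where
    expand : ∀ t x → x * x * x + t * x * x - (t + + 3) * x + + 1 ≡ (x * x * x - + 3 * x + 1ℤ) + (x * x - x) * t
    expand = solve-∀

  S : ℕ → ℤ
  S t = Σ p (λ x → χ (g (+ x) + h (+ x) * + t))

  charSum≡S : ∀ t → charSum p (+ t) ≡ S t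
  charSum≡S t = trans (sumℤ-upTo p (λ x → χ (cubic (+ t) (+ x))))
                      (Σ-cong p (λ x _ → cong χ (cubic≡g+h*t (+ t) (+ x))))

  D : ℤ → ℤ → ℤ
  D X Y = h X * g Y - g X * h Y

  Z : ℤ → ℤ → ℤ
  Z X Y = if does (P ∣? h X) then χ (g X) * χ (g Y) * [p∣ h Y ] else χ (h X) * χ (h Y) * [p∣ D X Y ]

  Z-degenerate : ∀ X Y → P ∣ h X → Z X Y ≡ χ (g X) * χ (g Y) * [p∣ h Y ]
  Z-degenerate X Y P∣hX =
    cong (λ b → if b then χ (g X) * χ (g Y) * [p∣ h Y ] else χ (h X) * χ (h Y) * [p∣ D X Y ]) (dec-true (P ∣? h X) P∣hX)

  Z-generic : ∀ X Y → ¬ P ∣ h X → Z X Y ≡ χ (h X) * χ (h Y) * [p∣ D X Y ]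
  Z-generic X Y P∤hX =
    cong (λ b → if b then χ (g X) * χ (g Y) * [p∣ h Y ] else χ (h X) * χ (h Y) * [p∣ D X Y ]) (dec-false (P ∣? h X) P∤hX)

  Σχ-pencil-correlation : ∀ X Y → Σ p (λ t → χ (g X + h X * + t) * χ (g Y + h Y * + t)) ≡ - (χ (h X) * χ (h Y)) + + p * Z X Y
  Σχ-pencil-correlation X Y = correlation (P ∣? h X) (P ∣? h Y)
    where
    open ≡-Reasoning
    χ-constant : ∀ {a b} → P ∣ b → ∀ t → χ (a + b * t) ≡ χ a
    χ-constant {a} {b} P∣b t = χ-≋ (≋-trans (≋-+ (≋-refl {a}) (P∣⇒≋0 (ℤD.∣m⇒∣m*n t P∣b))) (≡⇒≋ (ℤP.+-identityʳ a)))
    correlation : Dec (P ∣ h X) → Dec (P ∣ h Y) →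
                  Σ p (λ t → χ (g X + h X * + t) * χ (g Y + h Y * + t)) ≡ - (χ (h X) * χ (h Y)) + + p * Z X Y
    correlation (yes P∣hX) _ = begin
      Σ p (λ t → χ (g X + h X * + t) * χ (g Y + h Y * + t))  ≡⟨ Σ-cong p (λ t _ → cong (_* χ (g Y + h Y * + t)) (χ-constant P∣hX (+ t))) ⟩
      Σ p (λ t → χ (g X) * χ (g Y + h Y * + t))              ≡⟨ Σ-*ˡ p (χ (g X)) (λ t → χ (g Y + h Y * + t)) ⟩
      χ (g X) * Σ p (λ t → χ (g Y + h Y * + t))              ≡⟨ cong (χ (g X) *_) (Σχ-affine (g Y) (h Y)) ⟩
      χ (g X) * (+ p * ([p∣ h Y ] * χ (g Y)))                ≡⟨ regroup (χ (g X)) (χ (g Y)) [p∣ h Y ] (+ p) (χ (h Y)) ⟩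
      - (0ℤ * χ (h Y)) + + p * (χ (g X) * χ (g Y) * [p∣ h Y ]) ≡⟨ cong₂ (λ u v → - (u * χ (h Y)) + + p * v) (χ-divisible P∣hX) (Z-degenerate X Y P∣hX) ⟨
      - (χ (h X) * χ (h Y)) + + p * Z X Y                    ∎
      where
      regroup : ∀ a c i q f → a * (q * (i * c)) ≡ - (0ℤ * f) + q * (a * c * i)
      regroup = solve-∀
    correlation (no P∤hX) (yes P∣hY) = begin
      Σ p (λ t → χ (g X + h X * + t) * χ (g Y + h Y * + t))  ≡⟨ Σ-cong p (λ t _ → cong (χ (g X + h X * + t) *_) (χ-constant P∣hY (+ t))) ⟩
      Σ p (λ t → χ (g X + h X * + t) * χ (g Y))              ≡⟨ Σ-*ʳ p (λ t → χ (g X + h X * + t)) (χ (g Y)) ⟩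
      Σ p (λ t → χ (g X + h X * + t)) * χ (g Y)              ≡⟨ cong (_* χ (g Y)) (Σχ-affine (g X) (h X)) ⟩
      + p * ([p∣ h X ] * χ (g X)) * χ (g Y)                  ≡⟨ cong (λ i → + p * (i * χ (g X)) * χ (g Y)) ([p∣]-no P∤hX) ⟩
      + p * (0ℤ * χ (g X)) * χ (g Y)                         ≡⟨ regroup (χ (h X)) (+ p) [p∣ D X Y ] (χ (g X)) (χ (g Y)) ⟩
      - (χ (h X) * 0ℤ) + + p * (χ (h X) * 0ℤ * [p∣ D X Y ])  ≡⟨ cong (λ u → - (χ (h X) * u) + + p * (χ (h X) * u * [p∣ D X Y ])) (χ-divisible P∣hY) ⟨
      - (χ (h X) * χ (h Y)) + + p * (χ (h X) * χ (h Y) * [p∣ D X Y ]) ≡⟨ cong (λ z → - (χ (h X) * χ (h Y)) + + p * z) (Z-generic X Y P∤hX) ⟨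
      - (χ (h X) * χ (h Y)) + + p * Z X Y                    ∎
      where
      regroup : ∀ a q i b c → q * (0ℤ * b) * c ≡ - (a * 0ℤ) + q * (a * 0ℤ * i)
      regroup = solve-∀
    correlation (no P∤hX) (no P∤hY) = begin
      Σ p (λ t → χ (g X + h X * + t) * χ (g Y + h Y * + t))  ≡⟨ Σχχ-affine (g X) (h X) (g Y) (h Y) P∤hX P∤hY ⟩
      χ (h X) * χ (h Y) * (-1ℤ + + p * [p∣ D X Y ])          ≡⟨ regroup (χ (h X) * χ (h Y)) (+ p) [p∣ D X Y ] ⟩
      - (χ (h X) * χ (h Y)) + + p * (χ (h X) * χ (h Y) * [p∣ D X Y ]) ≡⟨ cong (λ z → - (χ (h X) * χ (h Y)) + + p * z) (Z-generic X Y P∤hX) ⟨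
      - (χ (h X) * χ (h Y)) + + p * Z X Y                    ∎
      where
      regroup : ∀ c q i → c * (-1ℤ + q * i) ≡ - c + q * (c * i)
      regroup = solve-∀

  Σχh≡-1 : Σ p (λ x → χ (h (+ x))) ≡ -1ℤ
  Σχh≡-1 = begin
    Σ p (λ x → χ (h (+ x)))                                ≡⟨ Σ-cong p (λ x _ → trans (cong χ (h-factor (+ x))) (χ-* (0ℤ + 1ℤ * + x) (-1ℤ + 1ℤ * + x))) ⟩
    Σ p (λ x → χ (0ℤ + 1ℤ * + x) * χ (-1ℤ + 1ℤ * + x))    ≡⟨ Σχχ-affine 0ℤ 1ℤ -1ℤ 1ℤ P∤1 P∤1 ⟩
    χ 1ℤ * χ 1ℤ * (-1ℤ + + p * [p∣ -1ℤ ])                  ≡⟨ cong₂ (λ u v → u * u * (-1ℤ + + p * v)) χ1≡1 ([p∣]-no P∤-1) ⟩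
    1ℤ * 1ℤ * (-1ℤ + + p * 0ℤ)                             ≡⟨ cong (λ z → 1ℤ * 1ℤ * (-1ℤ + z)) (ℤP.*-zeroʳ (+ p)) ⟩
    -1ℤ                                                    ∎
    where
    open ≡-Reasoning
    h-factor : ∀ x → x * x - x ≡ (0ℤ + 1ℤ * x) * (-1ℤ + 1ℤ * x)
    h-factor = solve-∀

  ΣZ : ℤ
  ΣZ = Σ p (λ x → Σ p (λ y → Z (+ x) (+ y)))

  second-moment : Σ p (λ t → S t * S t) ≡ -1ℤ + + p * ΣZ
  second-moment = begin
    Σ p (λ t → S t * S t)                                            ≡⟨ Σ-cong p (λ t _ → Σ-product p p (F t) (F t)) ⟩
    Σ p (λ t → Σ p (λ x → Σ p (λ y → F t x * F t y)))                 ≡⟨ Σ-swap p p (λ t x → Σ p (λ y → F t x * F t y)) ⟩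
    Σ p (λ x → Σ p (λ t → Σ p (λ y → F t x * F t y)))                 ≡⟨ Σ-cong p (λ x _ → Σ-swap p p (λ t y → F t x * F t y)) ⟩
    Σ p (λ x → Σ p (λ y → Σ p (λ t → F t x * F t y)))                 ≡⟨ Σ-cong p (λ x _ → Σ-cong p (λ y _ → Σχ-pencil-correlation (+ x) (+ y))) ⟩
    Σ p (λ x → Σ p (λ y → - (c x * c y) + + p * Z (+ x) (+ y)))       ≡⟨ Σ-cong p (λ x _ → Σ-+ p (λ y → - (c x * c y)) (λ y → + p * Z (+ x) (+ y))) ⟩
    Σ p (λ x → Σ p (λ y → - (c x * c y)) + Σ p (λ y → + p * Z (+ x) (+ y)))
                                                                     ≡⟨ Σ-+ p (λ x → Σ p (λ y → - (c x * c y))) (λ x → Σ p (λ y → + p * Z (+ x) (+ y))) ⟩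
    Σ p (λ x → Σ p (λ y → - (c x * c y))) + Σ p (λ x → Σ p (λ y → + p * Z (+ x) (+ y)))
                                                                     ≡⟨ cong₂ _+_ correlation-of-h scaled-ΣZ ⟩
    - (Σ p c * Σ p c) + + p * ΣZ                                     ≡⟨ cong (λ s → - (s * s) + + p * ΣZ) Σχh≡-1 ⟩
    -1ℤ + + p * ΣZ                                                   ∎
    where
    open ≡-Reasoning
    F : ℕ → ℕ → ℤ
    F t x = χ (g (+ x) + h (+ x) * + t)
    c : ℕ → ℤ
    c x = χ (h (+ x))
    correlation-of-h : Σ p (λ x → Σ p (λ y → - (c x * c y))) ≡ - (Σ p c * Σ p c)
    correlation-of-h = begin
      Σ p (λ x → Σ p (λ y → - (c x * c y)))   ≡⟨ Σ-cong p (λ x _ → Σ-neg p (λ y → c x * c y)) ⟩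
      Σ p (λ x → - Σ p (λ y → c x * c y))     ≡⟨ Σ-neg p (λ x → Σ p (λ y → c x * c y)) ⟩
      - Σ p (λ x → Σ p (λ y → c x * c y))     ≡⟨ cong -_ (Σ-product p p c c) ⟨
      - (Σ p c * Σ p c)                       ∎
    scaled-ΣZ : Σ p (λ x → Σ p (λ y → + p * Z (+ x) (+ y))) ≡ + p * ΣZ
    scaled-ΣZ = trans (Σ-cong p (λ x _ → Σ-*ˡ p (+ p) (λ y → Z (+ x) (+ y)))) (Σ-*ˡ p (+ p) (λ x → Σ p (λ y → Z (+ x) (+ y))))

  -- The row sums of Z

  Bounded-χ*[p∣] : ∀ a z → Bounded [p∣ z ] (χ a * [p∣ z ])
  Bounded-χ*[p∣] a z = case (P ∣? z)
    where
    case : Dec (P ∣ z) → Bounded [p∣ z ] (χ a * [p∣ z ])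
    case (yes P∣z) rewrite [p∣]-yes P∣z | ℤP.*-identityʳ (χ a) = -1≤χ a , χ≤1 a
    case (no P∤z) rewrite [p∣]-no P∤z | ℤP.*-zeroʳ (χ a) = ℤP.≤-refl , ℤP.≤-refl

  h≡X[X-1] : ∀ X → h X ≡ X * (X - 1ℤ)
  h≡X[X-1] = expand
    where
    expand : ∀ X → X * X - X ≡ X * (X - 1ℤ)
    expand = solve-∀

  P∤h⇒P∤X : ∀ X → ¬ P ∣ h X → ¬ P ∣ X
  P∤h⇒P∤X X P∤hX P∣X = P∤hX (P∣-resp (ℤD.∣m⇒∣m*n (X - 1ℤ) P∣X) (sym (h≡X[X-1] X)))

  P∤h⇒P∤X-1 : ∀ X → ¬ P ∣ h X → ¬ P ∣ X - 1ℤ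
  P∤h⇒P∤X-1 X P∤hX P∣X-1 = P∤hX (P∣-resp (ℤD.∣n⇒∣m*n X P∣X-1) (sym (h≡X[X-1] X)))

  ℓ₁ ℓ₂ ℓ₃ : ℤ → ℤ → ℤ
  ℓ₁ X Y = - X + 1ℤ * Y
  ℓ₂ X Y = (1ℤ - X) + X * Y
  ℓ₃ X Y = 1ℤ + (X - 1ℤ) * Y

  D-factorisation : ∀ X Y → D X Y ≡ ℓ₁ X Y * ℓ₂ X Y * ℓ₃ X Y
  D-factorisation = expand
    where
    expand : ∀ X Y → (X * X - X) * (Y * Y * Y - + 3 * Y + 1ℤ) - (X * X * X - + 3 * X + 1ℤ) * (Y * Y - Y)
                     ≡ (- X + 1ℤ * Y) * ((1ℤ - X) + X * Y) * (1ℤ + (X - 1ℤ) * Y)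
    expand = solve-∀

  Σ[p∣h]≤2 : Σ p (λ y → [p∣ h (+ y) ]) ≤ + 2
  Σ[p∣h]≤2 = ℤP.≤-trans (ℤP.≤-reflexive (Σ-cong p (λ y _ → cong [p∣_] (as-quadratic (+ y))))) (#roots-quadratic≤2 -1ℤ 0ℤ)
    where
    as-quadratic : ∀ y → y * y - y ≡ y * y + -1ℤ * y + 0ℤ
    as-quadratic = solve-∀

  ΣZ-row-bound : ∀ X → Bounded (+ 3) (Σ p (λ y → Z X (+ y)))
  ΣZ-row-bound X = row (P ∣? h X)
    where
    row : Dec (P ∣ h X) → Bounded (+ 3) (Σ p (λ y → Z X (+ y)))
    row (yes P∣hX) = Bounded-weaken (ℤP.≤-trans Σ[p∣h]≤2 (ℤ.+≤+ (s≤s (s≤s z≤n))))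
                       (Bounded-Σ p (λ y _ → Bounded-resp (sym (Z≡ (+ y))) (Bounded-χ*[p∣] (g X * g (+ y)) (h (+ y)))))
      where
      Z≡ : ∀ Y → Z X Y ≡ χ (g X * g Y) * [p∣ h Y ]
      Z≡ Y = trans (Z-degenerate X Y P∣hX) (cong (_* [p∣ h Y ]) (sym (χ-* (g X) (g Y))))
    row (no P∤hX) = Bounded-weaken (ℤP.≤-reflexive Σ-three-lines)
                      (Bounded-Σ p (λ y _ → Bounded-weaken (three-lines (+ y))
                                              (Bounded-resp (sym (Z≡ (+ y))) (Bounded-χ*[p∣] (h X * h (+ y)) (D X (+ y))))))
      where
      L : ℤ → ℤ
      L Y = [p∣ ℓ₁ X Y ] + [p∣ ℓ₂ X Y ] + [p∣ ℓ₃ X Y ]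
      Z≡ : ∀ Y → Z X Y ≡ χ (h X * h Y) * [p∣ D X Y ]
      Z≡ Y = trans (Z-generic X Y P∤hX) (cong (_* [p∣ D X Y ]) (sym (χ-* (h X) (h Y))))
      three-lines : ∀ Y → [p∣ D X Y ] ≤ L Y
      three-lines Y = begin
        [p∣ D X Y ]                             ≡⟨ cong [p∣_] (D-factorisation X Y) ⟩
        [p∣ ℓ₁ X Y * ℓ₂ X Y * ℓ₃ X Y ]          ≤⟨ [p∣*]≤ (ℓ₁ X Y * ℓ₂ X Y) (ℓ₃ X Y) ⟩
        [p∣ ℓ₁ X Y * ℓ₂ X Y ] + [p∣ ℓ₃ X Y ]    ≤⟨ ℤP.+-monoˡ-≤ [p∣ ℓ₃ X Y ] ([p∣*]≤ (ℓ₁ X Y) (ℓ₂ X Y)) ⟩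
        L Y                                     ∎
        where open ℤP.≤-Reasoning
      Σ-three-lines : Σ p (L ∘ +_) ≡ + 3
      Σ-three-lines = begin
        Σ p (L ∘ +_)                                                          ≡⟨ Σ-+ p (λ y → [p∣ ℓ₁ X (+ y) ] + [p∣ ℓ₂ X (+ y) ]) (λ y → [p∣ ℓ₃ X (+ y) ]) ⟩
        Σ p (λ y → [p∣ ℓ₁ X (+ y) ] + [p∣ ℓ₂ X (+ y) ]) + Σ p (λ y → [p∣ ℓ₃ X (+ y) ]) ≡⟨ cong (_+ Σ p (λ y → [p∣ ℓ₃ X (+ y) ])) (Σ-+ p (λ y → [p∣ ℓ₁ X (+ y) ]) (λ y → [p∣ ℓ₂ X (+ y) ])) ⟩
        Σ p (λ y → [p∣ ℓ₁ X (+ y) ]) + Σ p (λ y → [p∣ ℓ₂ X (+ y) ]) + Σ p (λ y → [p∣ ℓ₃ X (+ y) ])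
                                                                              ≡⟨ cong₂ _+_ (cong₂ _+_ (Σ[p∣affine] (- X) P∤1) (Σ[p∣affine] (1ℤ - X) (P∤h⇒P∤X X P∤hX)))
                                                                                                  (Σ[p∣affine] 1ℤ (P∤h⇒P∤X-1 X P∤hX)) ⟩
        + 3                                                                   ∎
        where open ≡-Reasoning

  h-≋ : ∀ {a b} → a ≋ b → h a ≋ h b
  h-≋ a≋b = ≋-+ (≋-* a≋b a≋b) (≋-neg a≋b)

  q : ℤ → ℤ
  q x = x * x - x + 1ℤ

  χh*χh-at-root₂ : ∀ {X R} → ¬ P ∣ h X → R * X ≋ X - 1ℤ → χ (h X) * χ (h R) ≡ χ (- X)
  χh*χh-at-root₂ {X} {R} P∤hX RX≋X-1 =
    trans (sym (χ-* (h X) (h R))) (χ-drop-square (∤*∤ (∤*∤ P∤X P∤R) P∤R-1) hXhR≋W²[-X])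
    where
    P∤X : ¬ P ∣ X
    P∤X = P∤h⇒P∤X X P∤hX
    P∤R : ¬ P ∣ R
    P∤R = P∤-of-*≋ RX≋X-1 (P∤h⇒P∤X-1 X P∤hX)
    [R-1]X≋-1 : (R - 1ℤ) * X ≋ -1ℤ
    [R-1]X≋-1 = ≋-trans (≡⇒≋ (expand R X)) (≋-trans (≋-+ RX≋X-1 (≋-refl { - X})) (≡⇒≋ (cancel X)))
      where
      expand : ∀ R X → (R - 1ℤ) * X ≡ R * X - X
      expand = solve-∀
      cancel : ∀ X → X - 1ℤ - X ≡ -1ℤ
      cancel = solve-∀
    P∤R-1 : ¬ P ∣ R - 1ℤ
    P∤R-1 = P∤-of-*≋ [R-1]X≋-1 P∤-1
    identity : ∀ X R → (X * X - X) * (R * R - R) ≡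
               X * R * (R - 1ℤ) * (X * R * (R - 1ℤ)) * - X + (R * X - (X - 1ℤ)) * (X * R * (R - 1ℤ) * (X * R - 1ℤ))
    identity = solve-∀
    hXhR≋W²[-X] : h X * h R ≋ X * R * (R - 1ℤ) * (X * R * (R - 1ℤ)) * - X
    hXhR≋W²[-X] = ≋-trans (≡⇒≋ (identity X R))
                    (≋-trans (≋-+ (≋-refl {W * W * - X}) (≋-* (P∣⇒≋0 (≋⇒P∣- RX≋X-1)) (≋-refl {E})))
                             (≡⇒≋ (ℤP.+-identityʳ (W * W * - X))))
      where
      W E : ℤ
      W = X * R * (R - 1ℤ)
      E = X * R * (R - 1ℤ) * (X * R - 1ℤ)

  χh*χh-at-root₃ : ∀ {X S} → ¬ P ∣ h X → S * (X - 1ℤ) ≋ -1ℤ → χ (h X) * χ (h S) ≡ χ (X - 1ℤ)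
  χh*χh-at-root₃ {X} {S} P∤hX S[X-1]≋-1 =
    trans (sym (χ-* (h X) (h S))) (χ-drop-square (∤*∤ (P∤h⇒P∤X X P∤hX) (P∤-of-*≋ S[X-1]≋-1 P∤-1)) hXhS≋W²[X-1])
    where
    identity : ∀ X S → (X * X - X) * (S * S - S) ≡ X * S * (X * S) * (X - 1ℤ) - X * (X - 1ℤ) * S * (S * (X - 1ℤ) - -1ℤ)
    identity = solve-∀
    hXhS≋W²[X-1] : h X * h S ≋ X * S * (X * S) * (X - 1ℤ)
    hXhS≋W²[X-1] = ≋-trans (≡⇒≋ (identity X S))
                     (≋-trans (≋-+ (≋-refl {W * W * (X - 1ℤ)}) (≋-neg (≋-* (≋-refl {X * (X - 1ℤ) * S}) (P∣⇒≋0 (≋⇒P∣- S[X-1]≋-1)))))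
                              (≡⇒≋ (minus-zero (W * W * (X - 1ℤ)) (X * (X - 1ℤ) * S))))
      where
      W : ℤ
      W = X * S
      minus-zero : ∀ a b → a - b * 0ℤ ≡ a
      minus-zero = solve-∀

  -- the three lines through which D X factors have pairwise distinct roots because p ∤ q X
  [p∣D]≡three-lines : ∀ X Y → ¬ P ∣ q X → [p∣ D X Y ] ≡ [p∣ ℓ₁ X Y ] + [p∣ ℓ₂ X Y ] + [p∣ ℓ₃ X Y ]
  [p∣D]≡three-lines X Y P∤qX = begin
    [p∣ D X Y ]                                   ≡⟨ cong [p∣_] (D-factorisation X Y) ⟩
    [p∣ ℓ₁ X Y * ℓ₂ X Y * ℓ₃ X Y ]                ≡⟨ [p∣*]≡ (ℓ₁ X Y * ℓ₂ X Y) (ℓ₃ X Y) exclusive₁₂,₃ ⟩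
    [p∣ ℓ₁ X Y * ℓ₂ X Y ] + [p∣ ℓ₃ X Y ]          ≡⟨ cong (_+ [p∣ ℓ₃ X Y ]) ([p∣*]≡ (ℓ₁ X Y) (ℓ₂ X Y) exclusive₁₂) ⟩
    [p∣ ℓ₁ X Y ] + [p∣ ℓ₂ X Y ] + [p∣ ℓ₃ X Y ]    ∎
    where
    open ≡-Reasoning
    identity₁₂ : ∀ X Y → (1ℤ - X + X * Y) - X * (- X + 1ℤ * Y) ≡ X * X - X + 1ℤ
    identity₁₂ = solve-∀
    identity₁₃ : ∀ X Y → 1ℤ + (X - 1ℤ) * Y - (X - 1ℤ) * (- X + 1ℤ * Y) ≡ X * X - X + 1ℤ
    identity₁₃ = solve-∀
    identity₂₃ : ∀ X Y → (1ℤ - X + X * Y) - (1ℤ + (X - 1ℤ) * Y) ≡ - X + 1ℤ * Y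
    identity₂₃ = solve-∀
    exclusive₁₂ : ¬ (P ∣ ℓ₁ X Y × P ∣ ℓ₂ X Y)
    exclusive₁₂ (P∣ℓ₁ , P∣ℓ₂) = P∤qX (P∣-resp (ℤD.∣m∣n⇒∣m-n P∣ℓ₂ (ℤD.∣n⇒∣m*n X P∣ℓ₁)) (identity₁₂ X Y))
    exclusive₁₃ : ¬ (P ∣ ℓ₁ X Y × P ∣ ℓ₃ X Y)
    exclusive₁₃ (P∣ℓ₁ , P∣ℓ₃) = P∤qX (P∣-resp (ℤD.∣m∣n⇒∣m-n P∣ℓ₃ (ℤD.∣n⇒∣m*n (X - 1ℤ) P∣ℓ₁)) (identity₁₃ X Y))
    exclusive₂₃ : ¬ (P ∣ ℓ₂ X Y × P ∣ ℓ₃ X Y)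
    exclusive₂₃ (P∣ℓ₂ , P∣ℓ₃) = exclusive₁₂ (P∣-resp (ℤD.∣m∣n⇒∣m-n P∣ℓ₂ P∣ℓ₃) (identity₂₃ X Y) , P∣ℓ₂)
    exclusive₁₂,₃ : ¬ (P ∣ ℓ₁ X Y * ℓ₂ X Y × P ∣ ℓ₃ X Y)
    exclusive₁₂,₃ (P∣ℓ₁ℓ₂ , P∣ℓ₃) =
      [ (λ P∣ℓ₁ → exclusive₁₃ (P∣ℓ₁ , P∣ℓ₃)) , (λ P∣ℓ₂ → exclusive₂₃ (P∣ℓ₂ , P∣ℓ₃)) ]′ (P∣*⇒ {ℓ₁ X Y} {ℓ₂ X Y} P∣ℓ₁ℓ₂)

  ΣZ-row-generic : ∀ X → ¬ P ∣ h X → ¬ P ∣ q X → Σ p (λ y → Z X (+ y)) ≡ 1ℤ + χ (- X) + χ (X - 1ℤ)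
  ΣZ-row-generic X P∤hX P∤qX = begin
    Σ p (λ y → Z X (+ y))                                           ≡⟨ Σ-cong p (λ y _ → Z-generic X (+ y) P∤hX) ⟩
    Σ p (λ y → G (+ y) * [p∣ D X (+ y) ])                           ≡⟨ Σ-cong p (λ y _ → split (+ y)) ⟩
    Σ p (λ y → A₁ y + A₂ y + A₃ y)                                  ≡⟨ Σ-+ p (λ y → A₁ y + A₂ y) A₃ ⟩
    Σ p (λ y → A₁ y + A₂ y) + Σ p A₃                                ≡⟨ cong (_+ Σ p A₃) (Σ-+ p A₁ A₂) ⟩
    Σ p A₁ + Σ p A₂ + Σ p A₃                                        ≡⟨ cong₂ _+_ (cong₂ _+_ (Σ-pick-root G G-periodic (- X) P∤1)
                                                                                            (Σ-pick-root G G-periodic (1ℤ - X) P∤X))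
                                                                                 (Σ-pick-root G G-periodic 1ℤ P∤X-1) ⟩
    G (root (- X) 1ℤ) + G (root (1ℤ - X) X) + G (root 1ℤ (X - 1ℤ)) ≡⟨ cong₂ _+_ (cong₂ _+_ value₁ value₂) value₃ ⟩
    1ℤ + χ (- X) + χ (X - 1ℤ)                                       ∎
    where
    open ≡-Reasoning
    P∤X : ¬ P ∣ X
    P∤X = P∤h⇒P∤X X P∤hX
    P∤X-1 : ¬ P ∣ X - 1ℤ
    P∤X-1 = P∤h⇒P∤X-1 X P∤hX
    G : ℤ → ℤ
    G Y = χ (h X) * χ (h Y)
    G-periodic : Periodic G
    G-periodic a≋b = cong (χ (h X) *_) (χ-≋ (h-≋ a≋b))
    A₁ A₂ A₃ : ℕ → ℤ
    A₁ y = G (+ y) * [p∣ ℓ₁ X (+ y) ]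
    A₂ y = G (+ y) * [p∣ ℓ₂ X (+ y) ]
    A₃ y = G (+ y) * [p∣ ℓ₃ X (+ y) ]
    distrib : ∀ g a b c → g * (a + b + c) ≡ g * a + g * b + g * c
    distrib = solve-∀
    split : ∀ Y → G Y * [p∣ D X Y ] ≡ G Y * [p∣ ℓ₁ X Y ] + G Y * [p∣ ℓ₂ X Y ] + G Y * [p∣ ℓ₃ X Y ]
    split Y = trans (cong (G Y *_) ([p∣D]≡three-lines X Y P∤qX)) (distrib (G Y) [p∣ ℓ₁ X Y ] [p∣ ℓ₂ X Y ] [p∣ ℓ₃ X Y ])
    value₁ : G (root (- X) 1ℤ) ≡ 1ℤ
    value₁ = begin
      G (root (- X) 1ℤ)      ≡⟨ G-periodic root≋X ⟩
      χ (h X) * χ (h X)      ≡⟨ χ-* (h X) (h X) ⟨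
      χ (h X * h X)          ≡⟨ χ-square P∤hX ⟩
      1ℤ                     ∎
      where
      root≋X : root (- X) 1ℤ ≋ X
      root≋X = ≋-trans (≡⇒≋ (sym (ℤP.*-identityʳ (root (- X) 1ℤ))))
                 (≋-trans (root-spec (- X) P∤1) (≡⇒≋ (ℤP.neg-involutive X)))
    value₂ : G (root (1ℤ - X) X) ≡ χ (- X)
    value₂ = χh*χh-at-root₂ {X} {root (1ℤ - X) X} P∤hX (≋-trans (root-spec (1ℤ - X) P∤X) (≡⇒≋ (flip X)))
      where
      flip : ∀ X → - (1ℤ - X) ≡ X - 1ℤ
      flip = solve-∀
    value₃ : G (root 1ℤ (X - 1ℤ)) ≡ χ (X - 1ℤ)
    value₃ = χh*χh-at-root₃ {X} {root 1ℤ (X - 1ℤ)} P∤hX (root-spec 1ℤ P∤X-1)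

  Bounded-χ : ∀ a → Bounded 1ℤ (χ a)
  Bounded-χ a = -1≤χ a , χ≤1 a

  row-value : ℤ → ℤ
  row-value X = 1ℤ + χ (- X) + χ (X - 1ℤ)

  row-deviation : ∀ X → Bounded (+ 6 * [p∣ h X * q X ]) (Σ p (λ y → Z X (+ y)) - row-value X)
  row-deviation X = case (P ∣? h X * q X)
    where
    deviation : ℤ
    deviation = Σ p (λ y → Z X (+ y)) - row-value X
    case : Dec (P ∣ h X * q X) → Bounded (+ 6 * [p∣ h X * q X ]) deviation
    case (yes P∣hq) = subst (λ i → Bounded (+ 6 * i) deviation) (sym ([p∣]-yes P∣hq))
      (Bounded-difference (ΣZ-row-bound X) (Bounded-+ (Bounded-+ (ℤP.≤-trans ℤ.-≤+ (ℤ.+≤+ z≤n) , ℤP.≤-refl) (Bounded-χ (- X))) (Bounded-χ (X - 1ℤ))))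
    case (no P∤hq) = subst (λ i → Bounded (+ 6 * i) deviation) (sym ([p∣]-no P∤hq))
      (Bounded-resp {0ℤ} (sym deviation≡0) (ℤP.≤-refl , ℤP.≤-refl))
      where
      P∤hX : ¬ P ∣ h X
      P∤hX = P∤hq ∘ ℤD.∣m⇒∣m*n (q X)
      P∤qX : ¬ P ∣ q X
      P∤qX = P∤hq ∘ ℤD.∣n⇒∣m*n (h X)
      deviation≡0 : deviation ≡ 0ℤ
      deviation≡0 = trans (cong (_- row-value X) (ΣZ-row-generic X P∤hX P∤qX)) (ℤP.+-inverseʳ (row-value X))

  Σrow-value≡p : Σ p (λ x → row-value (+ x)) ≡ + p
  Σrow-value≡p = begin
    Σ p (λ x → row-value (+ x))                                           ≡⟨ Σ-+ p (λ x → 1ℤ + χ (- + x)) (λ x → χ (+ x - 1ℤ)) ⟩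
    Σ p (λ x → 1ℤ + χ (- + x)) + Σ p (λ x → χ (+ x - 1ℤ))                 ≡⟨ cong (_+ Σ p (λ x → χ (+ x - 1ℤ))) (Σ-+ p (λ _ → 1ℤ) (λ x → χ (- + x))) ⟩
    Σ p (λ _ → 1ℤ) + Σ p (λ x → χ (- + x)) + Σ p (λ x → χ (+ x - 1ℤ))     ≡⟨ cong₂ _+_ (cong₂ _+_ (trans (Σ-const p 1ℤ) (ℤP.*-identityʳ (+ p))) Σχ-neg) Σχ-shift ⟩
    + p + 0ℤ + 0ℤ                                                         ≡⟨ cong (_+ 0ℤ) (ℤP.+-identityʳ (+ p)) ⟩
    + p + 0ℤ                                                              ≡⟨ ℤP.+-identityʳ (+ p) ⟩
    + p                                                                   ∎
    where
    open ≡-Reasoning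
    Σχ-neg : Σ p (λ x → χ (- + x)) ≡ 0ℤ
    Σχ-neg = begin
      Σ p (λ x → χ (- + x))                  ≡⟨ Σ-cong p (λ x _ → cong χ (as-line (+ x))) ⟩
      Σ p (λ x → χ (0ℤ + -1ℤ * + x))         ≡⟨ Σχ-affine 0ℤ -1ℤ ⟩
      + p * ([p∣ -1ℤ ] * χ 0ℤ)               ≡⟨ cong (λ i → + p * (i * χ 0ℤ)) ([p∣]-no P∤-1) ⟩
      + p * 0ℤ                               ≡⟨ ℤP.*-zeroʳ (+ p) ⟩
      0ℤ                                     ∎
      where
      as-line : ∀ x → - x ≡ 0ℤ + -1ℤ * x
      as-line = solve-∀
    Σχ-shift : Σ p (λ x → χ (+ x - 1ℤ)) ≡ 0ℤ
    Σχ-shift = begin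
      Σ p (λ x → χ (+ x - 1ℤ))               ≡⟨ Σ-cong p (λ x _ → cong χ (as-line (+ x))) ⟩
      Σ p (λ x → χ (-1ℤ + 1ℤ * + x))         ≡⟨ Σχ-affine -1ℤ 1ℤ ⟩
      + p * ([p∣ 1ℤ ] * χ -1ℤ)               ≡⟨ cong (λ i → + p * (i * χ -1ℤ)) ([p∣]-no P∤1) ⟩
      + p * 0ℤ                               ≡⟨ ℤP.*-zeroʳ (+ p) ⟩
      0ℤ                                     ∎
      where
      as-line : ∀ x → x - 1ℤ ≡ -1ℤ + 1ℤ * x
      as-line = solve-∀

  Σ[p∣q]≤2 : Σ p (λ x → [p∣ q (+ x) ]) ≤ + 2
  Σ[p∣q]≤2 = ℤP.≤-trans (ℤP.≤-reflexive (Σ-cong p (λ x _ → cong [p∣_] (as-quadratic (+ x))))) (#roots-quadratic≤2 -1ℤ 1ℤ)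
    where
    as-quadratic : ∀ x → x * x - x + 1ℤ ≡ x * x + -1ℤ * x + 1ℤ
    as-quadratic = solve-∀

  ΣZ-deviation : Bounded (+ 24) (ΣZ - + p)
  ΣZ-deviation = Bounded-resp ΣZ-p≡ (Bounded-weaken Σbound≤24 (Bounded-Σ p (λ x _ → row-deviation (+ x))))
    where
    open ℤP.≤-Reasoning
    ΣZ-p≡ : Σ p (λ x → Σ p (λ y → Z (+ x) (+ y)) - row-value (+ x)) ≡ ΣZ - + p
    ΣZ-p≡ = trans (Σ-difference p (λ x → Σ p (λ y → Z (+ x) (+ y))) (λ x → row-value (+ x))) (cong (_-_ ΣZ) Σrow-value≡p)
    Σbound≤24 : Σ p (λ x → + 6 * [p∣ h (+ x) * q (+ x) ]) ≤ + 24
    Σbound≤24 = begin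
      Σ p (λ x → + 6 * [p∣ h (+ x) * q (+ x) ])                   ≡⟨ Σ-*ˡ p (+ 6) (λ x → [p∣ h (+ x) * q (+ x) ]) ⟩
      + 6 * Σ p (λ x → [p∣ h (+ x) * q (+ x) ])                   ≤⟨ ℤP.*-monoˡ-≤-nonNeg (+ 6) (Σ-mono-≤ p (λ x _ → [p∣*]≤ (h (+ x)) (q (+ x)))) ⟩
      + 6 * Σ p (λ x → [p∣ h (+ x) ] + [p∣ q (+ x) ])             ≡⟨ cong (+ 6 *_) (Σ-+ p (λ x → [p∣ h (+ x) ]) (λ x → [p∣ q (+ x) ])) ⟩
      + 6 * (Σ p (λ x → [p∣ h (+ x) ]) + Σ p (λ x → [p∣ q (+ x) ])) ≤⟨ ℤP.*-monoˡ-≤-nonNeg (+ 6) (ℤP.+-mono-≤ Σ[p∣h]≤2 Σ[p∣q]≤2) ⟩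
      + 24                                                        ∎

  -- Q(1,p²) and Q(p²,1)

  qC : ℤ → ℤ
  qC t = t * t + + 3 * t + + 9

  ψ : ℕ → ℤ
  ψ t = 1ℤ - [p∣ qC (+ t) ]

  #C-roots : ℤ
  #C-roots = Σ p (λ t → [p∣ qC (+ t) ])

  Σψ≡p-#C-roots : Σ p ψ ≡ + p - #C-roots
  Σψ≡p-#C-roots = trans (Σ-difference p (λ _ → 1ℤ) (λ t → [p∣ qC (+ t) ])) (cong (_- #C-roots) (trans (Σ-const p 1ℤ) (ℤP.*-identityʳ (+ p))))

  #C-roots-bounded : Bounded (+ 2) #C-roots
  #C-roots-bounded = ℤP.≤-trans ℤ.-≤+ 0≤#C-roots , #roots-quadratic≤2 (+ 3) (+ 9)
    where
    0≤#C-roots : 0ℤ ≤ #C-roots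
    0≤#C-roots = ℤP.≤-trans (ℤP.≤-reflexive (sym (Σ-zero p))) (Σ-mono-≤ p (λ t _ → 0≤[p∣] (qC (+ t))))

  N : ℤ
  N = Σ p (λ t → S t * S t) - + p * Σ p ψ

  N-bound : Bounded (+ 27 * + p) N
  N-bound = Bounded-weaken 1+24p+2p≤27p
              (Bounded-resp N≡ (Bounded-+ (Bounded-+ Bounded-1 (Bounded-*ˡ p ΣZ-deviation)) (Bounded-*ˡ p #C-roots-bounded)))
    where
    Bounded-1 : Bounded 1ℤ -1ℤ
    Bounded-1 = ℤP.≤-refl , ℤ.-≤+
    regroup : ∀ q z c → -1ℤ + q * (z - q) + q * c ≡ -1ℤ + q * z - q * (q - c)
    regroup = solve-∀
    N≡ : -1ℤ + + p * (ΣZ - + p) + + p * #C-roots ≡ N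
    N≡ = trans (regroup (+ p) ΣZ #C-roots) (sym (cong₂ (λ u v → u - + p * v) second-moment Σψ≡p-#C-roots))
    1+24p+2p≤27p : 1ℤ + + p * + 24 + + p * + 2 ≤ + 27 * + p
    1+24p+2p≤27p = ℤP.≤-trans (ℤP.+-monoˡ-≤ (+ p * + 2) (ℤP.+-monoˡ-≤ (+ p * + 24) (ℤ.+≤+ 0<p))) (ℤP.≤-reflexive (collect (+ p)))
      where
      collect : ∀ q → q + q * + 24 + q * + 2 ≡ + 27 * q
      collect = solve-∀

  P∤8 : ¬ P ∣ + 8
  P∤8 P∣8 = [ P∤2 , P∤4 ]′ (P∣*⇒ {+ 2} {+ 4} P∣8)

  P∣C⇔P∣qC : ∀ t → (P ∣ Ccond t → P ∣ qC t) × (P ∣ qC t → P ∣ Ccond t)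
  P∣C⇔P∣qC t = to , from
    where
    to : P ∣ Ccond t → P ∣ qC t
    to P∣C = [ ⊥-elim ∘ P∤8 , reduce ∘ P∣*⇒ {qC t} {qC t} ]′ (P∣*⇒ {+ 8} {qC t * qC t} P∣C)
    from : P ∣ qC t → P ∣ Ccond t
    from P∣q = ℤD.∣n⇒∣m*n (+ 8) (ℤD.∣m⇒∣m*n (qC t) P∣q)

  psi≡fromℤψ : ∀ t → psi p (+ t) ≡ fromℤ (ψ t)
  psi≡fromℤψ t = case (P ∣? qC (+ t))
    where
    p∣?C : Dec (p ℕD.∣ ℤ.∣ Ccond (+ t) ∣)
    p∣?C = p ℕD.∣? ℤ.∣ Ccond (+ t) ∣
    case : Dec (P ∣ qC (+ t)) → psi p (+ t) ≡ fromℤ (ψ t)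
    case (yes P∣q) = trans (cong (λ b → if b then ℚ.0ℚ else ℚ.1ℚ) (trans (isYes≗does p∣?C) (dec-true p∣?C (ℤD.∣⇒∣ᵤ (proj₂ (P∣C⇔P∣qC (+ t)) P∣q)))))
                           (cong (λ i → fromℤ (1ℤ - i)) (sym ([p∣]-yes P∣q)))
    case (no P∤q) = trans (cong (λ b → if b then ℚ.0ℚ else ℚ.1ℚ) (trans (isYes≗does p∣?C) (dec-false p∣?C (P∤q ∘ proj₁ (P∣C⇔P∣qC (+ t)) ∘ ℤD.∣ᵤ⇒∣))))
                          (cong (λ i → fromℤ (1ℤ - i)) (sym ([p∣]-no P∤q)))

  Q-one-sq≡ : Q one sq p ≡ inv p ℚ.* fromℤ (Σ p ψ)
  Q-one-sq≡ = cong (inv p ℚ.*_) (begin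
    sumℚ (map (λ t → ℚ.1ℚ ℚ.* psi p (+ t)) (upTo p))   ≡⟨ sumℚ-cong (upTo p) (λ t → trans (ℚP.*-identityˡ (psi p (+ t))) (psi≡fromℤψ t)) ⟩
    sumℚ (map (fromℤ ∘ ψ) (upTo p))                     ≡⟨ sumℚ-fromℤ p ψ ⟩
    fromℤ (sumℤ (map ψ (upTo p)))                       ≡⟨ cong fromℤ (sumℤ-upTo p ψ) ⟩
    fromℤ (Σ p ψ)                                       ∎)
    where open ≡-Reasoning

  Q-one-sq-1≡ : Q one sq p ℚ.- ℚ.1ℚ ≡ fromℤ (- #C-roots) ℚ.* inv p
  Q-one-sq-1≡ = begin
    Q one sq p ℚ.- ℚ.1ℚ                           ≡⟨ cong₂ ℚ._-_ Q-one-sq≡ (sym (fromℤ-p*inv-p≡1 p)) ⟩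
    inv p ℚ.* fromℤ (Σ p ψ) ℚ.- fromℤ (+ p) ℚ.* inv p ≡⟨ regroup (fromℤ (Σ p ψ)) (fromℤ (+ p)) (inv p) ⟩
    (fromℤ (Σ p ψ) ℚ.- fromℤ (+ p)) ℚ.* inv p     ≡⟨ cong (ℚ._* inv p) (fromℤ-difference (Σ p ψ) (+ p)) ⟨
    fromℤ (Σ p ψ - + p) ℚ.* inv p                 ≡⟨ cong (λ z → fromℤ z ℚ.* inv p) (trans (cong (_- + p) Σψ≡p-#C-roots) (cancel (+ p) #C-roots)) ⟩
    fromℤ (- #C-roots) ℚ.* inv p                  ∎
    where
    open ≡-Reasoning
    regroup : ∀ (a c i : ℚ.ℚ) → i ℚ.* a ℚ.- c ℚ.* i ≡ (a ℚ.- c) ℚ.* i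
    regroup = RingSolver.solve-∀ ℚ-ring
    cancel : ∀ q c → q - c - q ≡ - c
    cancel = solve-∀

  Q-sq-one≡ : Q sq one p ≡ inv p ℚ.* (fromℤ N ℚ.* inv p)
  Q-sq-one≡ = cong (inv p ℚ.*_) (begin
    sumℚ (map (λ t → (lamSq p (+ t) ℚ.- psi p (+ t)) ℚ.* ℚ.1ℚ) (upTo p))   ≡⟨ sumℚ-cong (upTo p) term ⟩
    sumℚ (map (λ t → fromℤ (f t) ℚ.* inv p) (upTo p))                      ≡⟨ sumℚ-*ʳ (upTo p) (fromℤ ∘ f) (inv p) ⟩
    sumℚ (map (fromℤ ∘ f) (upTo p)) ℚ.* inv p                              ≡⟨ cong (ℚ._* inv p) (trans (sumℚ-fromℤ p f) (cong fromℤ (sumℤ-upTo p f))) ⟩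
    fromℤ (Σ p f) ℚ.* inv p                                                ≡⟨ cong (λ z → fromℤ z ℚ.* inv p) Σf≡N ⟩
    fromℤ N ℚ.* inv p                                                      ∎)
    where
    open ≡-Reasoning
    s : ℕ → ℤ
    s t = charSum p (+ t) * charSum p (+ t)
    f : ℕ → ℤ
    f t = s t - + p * ψ t
    regroup : ∀ (s ψ c i : ℚ.ℚ) → (s ℚ.* i ℚ.- ψ ℚ.* (c ℚ.* i)) ℚ.* ℚ.1ℚ ≡ (s ℚ.- c ℚ.* ψ) ℚ.* i
    regroup = RingSolver.solve-∀ ℚ-ring
    term : ∀ t → (lamSq p (+ t) ℚ.- psi p (+ t)) ℚ.* ℚ.1ℚ ≡ fromℤ (f t) ℚ.* inv p
    term t = begin
      (fromℤ (s t) ℚ.* inv p ℚ.- psi p (+ t)) ℚ.* ℚ.1ℚ                                 ≡⟨ cong (λ z → (fromℤ (s t) ℚ.* inv p ℚ.- z) ℚ.* ℚ.1ℚ) ψ≡ψ*p*inv ⟩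
      (fromℤ (s t) ℚ.* inv p ℚ.- fromℤ (ψ t) ℚ.* (fromℤ (+ p) ℚ.* inv p)) ℚ.* ℚ.1ℚ    ≡⟨ regroup (fromℤ (s t)) (fromℤ (ψ t)) (fromℤ (+ p)) (inv p) ⟩
      (fromℤ (s t) ℚ.- fromℤ (+ p) ℚ.* fromℤ (ψ t)) ℚ.* inv p                          ≡⟨ cong (λ z → (fromℤ (s t) ℚ.- z) ℚ.* inv p) (fromℤ-* (+ p) (ψ t)) ⟨
      (fromℤ (s t) ℚ.- fromℤ (+ p * ψ t)) ℚ.* inv p                                    ≡⟨ cong (ℚ._* inv p) (fromℤ-difference (s t) (+ p * ψ t)) ⟨
      fromℤ (f t) ℚ.* inv p                                                            ∎
      where
      ψ≡ψ*p*inv : psi p (+ t) ≡ fromℤ (ψ t) ℚ.* (fromℤ (+ p) ℚ.* inv p)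
      ψ≡ψ*p*inv = trans (psi≡fromℤψ t) (sym (trans (cong (fromℤ (ψ t) ℚ.*_) (fromℤ-p*inv-p≡1 p)) (ℚP.*-identityʳ (fromℤ (ψ t)))))
    Σf≡N : Σ p f ≡ N
    Σf≡N = trans (Σ-difference p s (λ t → + p * ψ t))
                 (cong₂ _-_ (Σ-cong p (λ t _ → cong₂ _*_ (charSum≡S t) (charSum≡S t))) (Σ-*ˡ p (+ p) ψ))

  Q-one-sq-bound : ℚ.∣ Q one sq p ℚ.- ℚ.1ℚ ∣ ℚ.≤ fromℤ (+ 2) ℚ.* inv p
  Q-one-sq-bound = subst (λ z → ℚ.∣ z ∣ ℚ.≤ fromℤ (+ 2) ℚ.* inv p) (sym Q-one-sq-1≡)
    (∣fromℤ*∣≤ (inv p) (0≤inv p) (Bounded-neg #C-roots-bounded))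

  Q-sq-one-bound : ℚ.∣ Q sq one p ∣ ℚ.≤ fromℤ (+ 27) ℚ.* inv p
  Q-sq-one-bound = begin
    ℚ.∣ Q sq one p ∣                                       ≡⟨ cong ℚ.∣_∣ Q-sq-one≡ ⟩
    ℚ.∣ inv p ℚ.* (fromℤ N ℚ.* inv p) ∣                    ≡⟨ ℚP.∣p*q∣≡∣p∣*∣q∣ (inv p) (fromℤ N ℚ.* inv p) ⟩
    ℚ.∣ inv p ∣ ℚ.* ℚ.∣ fromℤ N ℚ.* inv p ∣                ≡⟨ cong (ℚ._* ℚ.∣ fromℤ N ℚ.* inv p ∣) (ℚP.0≤p⇒∣p∣≡p (0≤inv p)) ⟩
    inv p ℚ.* ℚ.∣ fromℤ N ℚ.* inv p ∣                      ≤⟨ ℚP.*-monoˡ-≤-nonNeg (inv p) {{ℚ.nonNegative (0≤inv p)}}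
                                                                (∣fromℤ*∣≤ (inv p) (0≤inv p) N-bound) ⟩
    inv p ℚ.* (fromℤ (+ 27 * + p) ℚ.* inv p)               ≡⟨ cong (λ z → inv p ℚ.* (z ℚ.* inv p)) (fromℤ-* (+ 27) (+ p)) ⟩
    inv p ℚ.* (fromℤ (+ 27) ℚ.* fromℤ (+ p) ℚ.* inv p)     ≡⟨ regroup (inv p) (fromℤ (+ 27)) (fromℤ (+ p)) ⟩
    fromℤ (+ 27) ℚ.* inv p ℚ.* (fromℤ (+ p) ℚ.* inv p)     ≡⟨ cong (fromℤ (+ 27) ℚ.* inv p ℚ.*_) (fromℤ-p*inv-p≡1 p) ⟩
    fromℤ (+ 27) ℚ.* inv p ℚ.* ℚ.1ℚ                        ≡⟨ ℚP.*-identityʳ (fromℤ (+ 27) ℚ.* inv p) ⟩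
    fromℤ (+ 27) ℚ.* inv p                                 ∎
    where
    open ℚP.≤-Reasoning
    regroup : ∀ (i k c : ℚ.ℚ) → i ℚ.* (k ℚ.* c ℚ.* i) ≡ k ℚ.* i ℚ.* (c ℚ.* i)
    regroup = RingSolver.solve-∀ ℚ-ring


open import Data.Nat using (_<_)
open import Data.Rational using (ℚ; ∣_∣; _≤_; _*_; _-_; 1ℚ)
open import Data.Product using (_×_; _,_; ∃-syntax)
open import Data.Integer using (+_)
open IntegersInRationals using (fromℤ)

lemma3p4 : (∃[ K ] ∀ (p : ℕ) → Prime p → 2 < p → ∣ Q one sq p - 1ℚ ∣ ≤ K * inv p)
           × (∃[ K ] ∀ (p : ℕ) → Prime p → 2 < p → ∣ Q sq one p ∣ ≤ K * inv p)
lemma3p4 = (fromℤ (+ 2) , PrimeField.Q-one-sq-bound) , (fromℤ (+ 27) , PrimeField.Q-sq-one-bound)
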